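{- Let $m\geq1$, let $M$ be a loopless matroid on $E$ and $Q=Q_m(M)$ with tip $a$. The Tutte polynomials of $Q\setminus a$, of $Q\setminus E$, and of $Q\setminus(E\cup\{a\})$ can each be determined from the size-rank-coloop data of $M$; that is, if loopless matroids $M$ and $N$ have the same size-rank-coloop data, then the corresponding deletions of $Q_m(M)$ and $Q_m(N)$ have equal Tutte polynomials.
   Context: The Tutte polynomial of $M=(E,r)$ is $T(M;x,y)=\sum_{A\subseteq E}(x-1)^{r(E)-r(A)}(y-1)^{|A|-r(A)}$. The size-rank-coloop data of $M$ is the multiset of triples $(|S|,r(S),c(S))$ over all $S\subseteq E$, where $c(S)$ is the number of coloops of $M|S$. Cyclic set: $X$ with $M|X$ having no coloops; cyclic flat: a flat that is cyclic; $\mathcal{Z}(M)$: the set of cyclic flats. Free $m$-cone: let $M=(E,r)$ be loopless and $m\geq1$. For each $e\in E$ let $T_e$ be a set of $m$ new elements (pairwise disjoint, disjoint from $E$), $T=\bigcup_e T_e$, and $a$ a further new element (the tip); $E(Q)=E\cup T\cup\{a\}$. For $S\subseteq E$ let $q(S)=S\cup\{a\}\cup\bigcup_{e\in S}T_e$. The free $m$-cone $Q_m(M)$ is the unique matroid on $E(Q)$ whose cyclic flats are exactly the sets in $\mathcal{Z}(M)\cup\{q(F):F\text{ a nonempty flat of }M\}$, with rank $r(Z)$ on $Z\in\mathcal{Z}(M)$ and rank $r(F)+1$ on $q(F)$. -}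

module Defs where

open import Data.Nat as ℕ using (ℕ; zero; suc; _+_; _*_; _∸_; _≤_; _<_; _<ᵇ_)
open import Data.Integer as ℤ using (ℤ; +_; _^_) renaming (_*_ to _*ℤ_; _+_ to _+ℤ_; _-_ to _-ℤ_)
open import Data.Bool using (Bool; true; false; if_then_else_; _∧_)
open import Data.Fin using (Fin)
open import Data.Fin.Subset using (Subset; _∈_; _∉_; _⊆_; _∪_; _∩_; _-_; ⁅_⁆; ∣_∣; Nonempty)
open import Data.Vec using (Vec; []; _∷_; _++_; replicate; concat; map; lookup)
open import Data.List as List using (List; [_]; allFin)
open import Data.Product using (_×_; _,_; ∃; ∃-syntax)
open import Data.Sum using (_⊎_)
open import Relation.Binary.PropositionalEquality using (_≡_)
open import Function.Bundles using (_⇔_)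
open import Data.Nat.ListAction using (sum)

record Matroid (k : ℕ) : Set where
  field
    rank       : Subset k → ℕ
    rank-bound : ∀ X → rank X ≤ ∣ X ∣
    rank-mono  : ∀ X Y → X ⊆ Y → rank X ≤ rank Y
    rank-submod : ∀ X Y → rank (X ∪ Y) + rank (X ∩ Y) ≤ rank X + rank Y
open Matroid public

module _ {k : ℕ} (M : Matroid k) where

  Loopless : Set
  Loopless = ∀ (e : Fin k) → rank M ⁅ e ⁆ ≡ 1

  IsFlat : Subset k → Set
  IsFlat X = ∀ (e : Fin k) → e ∉ X → rank M X < rank M (X ∪ ⁅ e ⁆)

  IsColoopOf : Subset k → Fin k → Set
  IsColoopOf X e = e ∈ X × rank M (X - e) < rank M X

  IsCyclic : Subset k → Set
  IsCyclic X = ∀ (e : Fin k) → e ∈ X → rank M (X - e) ≡ rank M X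

  IsCyclicFlat : Subset k → Set
  IsCyclicFlat X = IsFlat X × IsCyclic X

  coloops : Subset k → ℕ
  coloops S = sum (List.map f (allFin k))
    where
    f : Fin k → ℕ
    f e = if lookup S e ∧ (rank M (S - e) <ᵇ rank M S) then 1 else 0

allSubsets : (k : ℕ) → List (Subset k)
allSubsets zero    = [ [] ]
allSubsets (suc k) = List.map (true ∷_) (allSubsets k) List.++ List.map (false ∷_) (allSubsets k)

subsetsOf : ∀ {k} → Subset k → List (Subset k)
subsetsOf []          = [ [] ]
subsetsOf (true ∷ S)  = List.map (true ∷_) (subsetsOf S) List.++ List.map (false ∷_) (subsetsOf S)
subsetsOf (false ∷ S) = List.map (false ∷_) (subsetsOf S)

-- size-rank-coloop data: the multiset (as a list, compared up to
-- permutation) of triples (|S|, r(S), c(S)) over all S ⊆ E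
srcData : ∀ {k} → Matroid k → List (ℕ × ℕ × ℕ)
srcData {k} M = List.map (λ S → ∣ S ∣ , rank M S , coloops M S) (allSubsets k)

-- Tutte polynomial of the restriction M|S (= deletion of the complement
-- of S), as a polynomial function ℤ → ℤ → ℤ:
--   T(M|S; x, y) = Σ_{A ⊆ S} (x-1)^{r(S)-r(A)} (y-1)^{|A|-r(A)}

tutteRestr : ∀ {k} → Matroid k → Subset k → ℤ → ℤ → ℤ
tutteRestr M S x y =
  List.foldr _+ℤ_ (+ 0)
    (List.map (λ A → ((x -ℤ + 1) ^ (rank M S ∸ rank M A)) *ℤ ((y -ℤ + 1) ^ (∣ A ∣ ∸ rank M A)))
              (subsetsOf S))

-- Free m-cone.  Ground set of Q_m(M) for M on Fin n is
-- Fin (suc (n + n * m)), laid out as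
--   [ a ] ++ [ E (n elements) ] ++ [ T_{e_0} (m) ] ++ ... ++ [ T_{e_{n-1}} (m) ]

ConeSize : ℕ → ℕ → ℕ
ConeSize n m = suc (n + n * m)

embE : ∀ {n} m → Subset n → Subset (ConeSize n m)
embE {n} m S = false ∷ (S ++ replicate (n * m) false)

-- q(S) = S ∪ {a} ∪ ⋃_{e∈S} T_e
qSet : ∀ {n} m → Subset n → Subset (ConeSize n m)
qSet {n} m S = true ∷ (S ++ concat (map (λ b → replicate m b) S))

groundMinusTip : ∀ n m → Subset (ConeSize n m)
groundMinusTip n m = false ∷ (replicate n true ++ replicate (n * m) true)

groundMinusE : ∀ n m → Subset (ConeSize n m)
groundMinusE n m = true ∷ (replicate n false ++ replicate (n * m) true)

groundMinusEa : ∀ n m → Subset (ConeSize n m)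
groundMinusEa n m = false ∷ (replicate n false ++ replicate (n * m) true)

-- Q is the free m-cone of (loopless) M: its cyclic flats are exactly
-- Z(M) ∪ {q(F) : F nonempty flat of M}, with the prescribed ranks.
-- (A matroid is determined by its cyclic flats and their ranks.)
IsFreeCone : ∀ {n} (m : ℕ) → Matroid n → Matroid (ConeSize n m) → Set
IsFreeCone {n} m M Q =
  (∀ (Z : Subset (ConeSize n m)) →
      IsCyclicFlat Q Z ⇔
        ((∃[ Z′ ] (IsCyclicFlat M Z′ × Z ≡ embE m Z′))
         ⊎ (∃[ F ] (IsFlat M F × Nonempty F × Z ≡ qSet m F))))
  × (∀ (Z : Subset n) → IsCyclicFlat M Z → rank Q (embE m Z) ≡ rank M Z)
  × (∀ (F : Subset n) → IsFlat M F → Nonempty F → rank Q (qSet m F) ≡ suc (rank M F))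

-- Write a subset of Q ∖ a as A ∪ Y with A ⊆ E and Y ⊆ T, and let supp Y be the set of e whose
-- block T_e meets Y. Since r(X) = min { r(Z) + |X − Z| : Z cyclic flat } and the cyclic flats of
-- the cone are known, r_Q(A ∪ Y) = min(r(A) + |Y|, 1 + r(A ∪ supp Y)), and adding the tip adds 1 to
-- the first term. Grouping the Tutte sum by S = supp Y, the sizes |Y| range over a multiset
-- depending only on |S|. For Q ∖ E and Q ∖ (E ∪ a) we have A = ∅, so the Tutte polynomial is a sum
-- over S of a function of (|S|, r(S)). For Q ∖ a, reindex the pairs (A, S) by W = A ∪ S, A and
-- B = A ∩ S; the minimum equals r(W) exactly when |Y| = |W − A| and r(A) + |W − A| = r(W), that is,
-- when W − A consists of coloops of M|W. Summing over A ⊆ W then leaves a function of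
-- (|W|, r(W), c(W)).

module Submission where

open import Defs
open import Data.Bool using (Bool; true; false; _∧_; _∨_; if_then_else_; T)
import Data.Bool.Properties as Bool
open import Data.Empty using (⊥-elim)
open import Data.Fin as Fin using (Fin)
open import Data.Fin.Properties using (all?; ¬∀⟶∃¬) renaming (_≟_ to _≟ᶠ_)
open import Data.Fin.Subset
open import Data.Fin.Subset.Properties
open import Data.Integer as ℤ using (ℤ; 0ℤ; 1ℤ; _^_)
  renaming (_+_ to _+ℤ_; _-_ to _-ℤ_; _*_ to _*ℤ_)
import Data.Integer.Properties as ℤ
import Algebra.Properties.CommutativeSemigroup ℤ.+-commutativeSemigroup as ℤ+
open import Data.Integer.Tactic.RingSolver using (solve-∀)
open import Data.Nat.Tactic.RingSolver using () renaming (solve-∀ to solve-∀ℕ)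
open import Data.List as List using (List; [_])
import Data.List.Properties as List
open import Data.List.Relation.Unary.All as All using (All)
open import Data.List.Relation.Unary.Any using (here)
open import Data.List.Membership.Propositional using () renaming (_∈_ to _∈ₗ_)
open import Data.List.Membership.Propositional.Properties using (∈-map⁺; ∈-map⁻; ∈-++⁺ˡ)
open import Data.List.Relation.Binary.Permutation.Propositional using (_↭_; ↭-sym; ↭⇒↭ₛ)
import Data.List.Relation.Binary.Permutation.Propositional.Properties as ↭
open import Data.List.Relation.Binary.Permutation.Propositional.Properties using (∈-resp-↭)
open import Data.List.Relation.Binary.Permutation.Setoid.Properties using (foldr-commMonoid)
import Data.List.Relation.Unary.All.Properties as All
open import Data.Nat using (ℕ; zero; suc; _+_; _*_; _∸_; _≤_; _<_; z≤n; s≤s; _⊓_; _<ᵇ_; _<?_; _≟_)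
open import Data.Nat.Properties
open import Data.Nat.ListAction using (sum)
open import Data.Product using (_×_; _,_; ∃-syntax; proj₁; proj₂)
open import Data.Sum using (_⊎_; inj₁; inj₂)
open import Data.Vec
  using (Vec; []; _∷_; here; there; _++_; replicate; concat; map; lookup; tabulate; take; drop; splitAt)
open import Data.Vec.Properties using ([]=⇒lookup; lookup⇒[]=; lookup∘tabulate)
open import Function using (_∘_; id)
open import Function.Bundles using (_⇔_; mk⇔; Equivalence)
open import Relation.Nullary using (¬_; Dec; yes; no; does)
open import Relation.Nullary.Decidable using (¬?; _→-dec_; does-⇔; decidable-stable)
open import Relation.Binary.PropositionalEquality
  using (_≡_; refl; sym; trans; cong; cong₂; subst; module ≡-Reasoning)

bit : Bool → ℕ
bit true  = 1
bit false = 0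

x∈p─q⁻ : ∀ {n} {x : Fin n} (p q : Subset n) → x ∈ p ─ q → x ∈ p × x ∉ q
x∈p─q⁻ (true ∷ p) (false ∷ q) here = here , λ ()
x∈p─q⁻ {x = Fin.zero} (false ∷ p) (false ∷ q) ()
x∈p─q⁻ {x = Fin.zero} (_ ∷ p)     (true ∷ q)  ()
x∈p─q⁻ (_ ∷ p) (_ ∷ q) (there x∈p─q) =
  there (proj₁ (x∈p─q⁻ p q x∈p─q)) , λ { (there x∈q) → proj₂ (x∈p─q⁻ p q x∈p─q) x∈q }

∣Empty∣≡0 : ∀ {n} {p : Subset n} → Empty p → ∣ p ∣ ≡ 0
∣Empty∣≡0 {n} empty = trans (cong ∣_∣ (Empty-unique empty)) (∣⊥∣≡0 n)

∣x∷p∣ : ∀ {n} x (p : Subset n) → ∣ x ∷ p ∣ ≡ bit x + ∣ p ∣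
∣x∷p∣ true  p = refl
∣x∷p∣ false p = refl

∣p++q∣ : ∀ {a b} (p : Subset a) (q : Subset b) → ∣ p ++ q ∣ ≡ ∣ p ∣ + ∣ q ∣
∣p++q∣ []      q = refl
∣p++q∣ (x ∷ p) q = begin
  ∣ x ∷ (p ++ q) ∣         ≡⟨ ∣x∷p∣ x (p ++ q) ⟩
  bit x + ∣ p ++ q ∣       ≡⟨ cong (bit x +_) (∣p++q∣ p q) ⟩
  bit x + (∣ p ∣ + ∣ q ∣)  ≡⟨ +-assoc (bit x) _ _ ⟨
  (bit x + ∣ p ∣) + ∣ q ∣  ≡⟨ cong (_+ ∣ q ∣) (∣x∷p∣ x p) ⟨
  ∣ x ∷ p ∣ + ∣ q ∣        ∎
  where open ≡-Reasoning

++-─ : ∀ {a b} (p p′ : Subset a) (q q′ : Subset b) → (p ++ q) ─ (p′ ++ q′) ≡ (p ─ p′) ++ (q ─ q′)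
++-─ []      []       q q′ = refl
++-─ (x ∷ p) (y ∷ p′) q q′ = cong (_ ∷_) (++-─ p p′ q q′)

∣p++q─p′++q′∣ : ∀ {a b} (p p′ : Subset a) (q q′ : Subset b) →
                ∣ (p ++ q) ─ (p′ ++ q′) ∣ ≡ ∣ p ─ p′ ∣ + ∣ q ─ q′ ∣
∣p++q─p′++q′∣ p p′ q q′ = trans (cong ∣_∣ (++-─ p p′ q q′)) (∣p++q∣ (p ─ p′) (q ─ q′))

∣p─q∣+∣p∩q∣≡∣p∣ : ∀ {n} (p q : Subset n) → ∣ p ─ q ∣ + ∣ p ∩ q ∣ ≡ ∣ p ∣
∣p─q∣+∣p∩q∣≡∣p∣ []         []         = refl
∣p─q∣+∣p∩q∣≡∣p∣ (true ∷ p)  (true ∷ q)  = trans (+-suc _ _) (cong suc (∣p─q∣+∣p∩q∣≡∣p∣ p q))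
∣p─q∣+∣p∩q∣≡∣p∣ (true ∷ p)  (false ∷ q) = cong suc (∣p─q∣+∣p∩q∣≡∣p∣ p q)
∣p─q∣+∣p∩q∣≡∣p∣ (false ∷ p) (true ∷ q)  = ∣p─q∣+∣p∩q∣≡∣p∣ p q
∣p─q∣+∣p∩q∣≡∣p∣ (false ∷ p) (false ∷ q) = ∣p─q∣+∣p∩q∣≡∣p∣ p q

∣p∪q∣+∣p∩q∣≡∣p∣+∣q∣ : ∀ {n} (p q : Subset n) → ∣ p ∪ q ∣ + ∣ p ∩ q ∣ ≡ ∣ p ∣ + ∣ q ∣
∣p∪q∣+∣p∩q∣≡∣p∣+∣q∣ []          []          = refl
∣p∪q∣+∣p∩q∣≡∣p∣+∣q∣ (true ∷ p)  (true ∷ q)  =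
  cong suc (trans (+-suc _ _) (trans (cong suc (∣p∪q∣+∣p∩q∣≡∣p∣+∣q∣ p q)) (sym (+-suc _ _))))
∣p∪q∣+∣p∩q∣≡∣p∣+∣q∣ (true ∷ p)  (false ∷ q) = cong suc (∣p∪q∣+∣p∩q∣≡∣p∣+∣q∣ p q)
∣p∪q∣+∣p∩q∣≡∣p∣+∣q∣ (false ∷ p) (true ∷ q)  =
  trans (cong suc (∣p∪q∣+∣p∩q∣≡∣p∣+∣q∣ p q)) (sym (+-suc _ _))
∣p∪q∣+∣p∩q∣≡∣p∣+∣q∣ (false ∷ p) (false ∷ q) = ∣p∪q∣+∣p∩q∣≡∣p∣+∣q∣ p q

∣p∪q∣≤∣p∣+∣q∣ : ∀ {n} (p q : Subset n) → ∣ p ∪ q ∣ ≤ ∣ p ∣ + ∣ q ∣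
∣p∪q∣≤∣p∣+∣q∣ p q = ≤-trans (m≤m+n _ _) (≤-reflexive (∣p∪q∣+∣p∩q∣≡∣p∣+∣q∣ p q))

∣[p∪q]─r∣≤∣p─r∣+∣q─r∣ : ∀ {n} (p q r : Subset n) → ∣ (p ∪ q) ─ r ∣ ≤ ∣ p ─ r ∣ + ∣ q ─ r ∣
∣[p∪q]─r∣≤∣p─r∣+∣q─r∣ p q r = ≤-trans (p⊆q⇒∣p∣≤∣q∣ [p∪q]─r⊆) (∣p∪q∣≤∣p∣+∣q∣ (p ─ r) (q ─ r))
  where
  [p∪q]─r⊆ : (p ∪ q) ─ r ⊆ (p ─ r) ∪ (q ─ r)
  [p∪q]─r⊆ x∈ with x∈p─q⁻ (p ∪ q) r x∈
  ... | x∈p∪q , x∉r with x∈p∪q⁻ p q x∈p∪q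
  ...   | inj₁ x∈p = x∈p∪q⁺ (inj₁ (x∈p∧x∉q⇒x∈p─q x∈p x∉r))
  ...   | inj₂ x∈q = x∈p∪q⁺ (inj₂ (x∈p∧x∉q⇒x∈p─q x∈q x∉r))

bit≤1 : ∀ b → bit b ≤ 1
bit≤1 true  = s≤s z≤n
bit≤1 false = z≤n

∣p∪⁅x⁆∣≤1+∣p∣ : ∀ {n} (p : Subset n) x → ∣ p ∪ ⁅ x ⁆ ∣ ≤ suc ∣ p ∣
∣p∪⁅x⁆∣≤1+∣p∣ p x = ≤-trans (∣p∪q∣≤∣p∣+∣q∣ p ⁅ x ⁆)
  (≤-reflexive (trans (cong (∣ p ∣ +_) (∣⁅x⁆∣≡1 x)) (+-comm _ 1)))

∣X─[Z-e]∣≤1+∣X─Z∣ : ∀ {n} (X Z : Subset n) e → ∣ X ─ (Z - e) ∣ ≤ suc ∣ X ─ Z ∣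
∣X─[Z-e]∣≤1+∣X─Z∣ X Z e = ≤-trans (p⊆q⇒∣p∣≤∣q∣ X─[Z-e]⊆) (∣p∪⁅x⁆∣≤1+∣p∣ (X ─ Z) e)
  where
  X─[Z-e]⊆ : X ─ (Z - e) ⊆ (X ─ Z) ∪ ⁅ e ⁆
  X─[Z-e]⊆ {x} x∈ with x ≟ᶠ e
  ... | yes refl = x∈p∪q⁺ (inj₂ (x∈⁅x⁆ x))
  ... | no  x≢e  = let x∈X , x∉Z-e = x∈p─q⁻ X (Z - e) x∈ in
    x∈p∪q⁺ (inj₁ (x∈p∧x∉q⇒x∈p─q x∈X λ x∈Z → x∉Z-e (x∈p∧x∉q⇒x∈p─q x∈Z (x≢y⇒x∉⁅y⁆ x≢e))))

∣p∣≡1+∣p-x∣ : ∀ {n} {x : Fin n} {p : Subset n} → x ∈ p → ∣ p ∣ ≡ suc ∣ p - x ∣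
∣p∣≡1+∣p-x∣ {x = x} {p} x∈p = begin
  ∣ p ∣                          ≡⟨ ∣p─q∣+∣p∩q∣≡∣p∣ p ⁅ x ⁆ ⟨
  ∣ p - x ∣ + ∣ p ∩ ⁅ x ⁆ ∣      ≡⟨ cong (λ q → ∣ p - x ∣ + ∣ q ∣) p∩⁅x⁆≡⁅x⁆ ⟩
  ∣ p - x ∣ + ∣ ⁅ x ⁆ ∣          ≡⟨ cong (∣ p - x ∣ +_) (∣⁅x⁆∣≡1 x) ⟩
  ∣ p - x ∣ + 1                  ≡⟨ +-comm _ 1 ⟩
  suc ∣ p - x ∣                  ∎
  where
  open ≡-Reasoning
  p∩⁅x⁆≡⁅x⁆ : p ∩ ⁅ x ⁆ ≡ ⁅ x ⁆
  p∩⁅x⁆≡⁅x⁆ = ⊆-antisym (p∩q⊆q p ⁅ x ⁆)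
    λ y∈⁅x⁆ → x∈p∩q⁺ (subst (_∈ p) (sym (x∈⁅y⁆⇒x≡y x y∈⁅x⁆)) x∈p , y∈⁅x⁆)

∈⇔T-lookup : ∀ {n} {x : Fin n} {p : Subset n} → x ∈ p ⇔ T (lookup p x)
∈⇔T-lookup {x = x} {p} = mk⇔
  (λ x∈p → Equivalence.from Bool.T-≡ ([]=⇒lookup x∈p))
  (λ t → lookup⇒[]= x p (Equivalence.to Bool.T-≡ t))

∣p∣<∣p∪⁅x⁆∣ : ∀ {n} {x : Fin n} {p : Subset n} → x ∉ p → ∣ p ∣ < ∣ p ∪ ⁅ x ⁆ ∣
∣p∣<∣p∪⁅x⁆∣ {x = x} x∉p = p⊂q⇒∣p∣<∣q∣ (p⊆p∪q ⁅ x ⁆ , x , x∈p∪q⁺ (inj₂ (x∈⁅x⁆ x)) , x∉p)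

∣tabulate∣ : ∀ {n} (g : Fin n → Bool) → ∣ tabulate g ∣ ≡ sum (List.tabulate λ e → if g e then 1 else 0)
∣tabulate∣ {zero}  g = refl
∣tabulate∣ {suc n} g =
  trans (∣x∷p∣ (g Fin.zero) (tabulate (g ∘ Fin.suc))) (cong₂ _+_ (bit≡ (g Fin.zero)) (∣tabulate∣ (g ∘ Fin.suc)))
  where
  bit≡ : ∀ b → bit b ≡ (if b then 1 else 0)
  bit≡ true  = refl
  bit≡ false = refl

module _ {n} {W A : Subset n} (A⊆W : A ⊆ W) where

  ∣W─A∣≡∣W∣∸∣A∣ : ∣ W ─ A ∣ ≡ ∣ W ∣ ∸ ∣ A ∣
  ∣W─A∣≡∣W∣∸∣A∣ = begin
    ∣ W ─ A ∣                           ≡⟨ m+n∸n≡m _ ∣ A ∣ ⟨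
    ∣ W ─ A ∣ + ∣ A ∣ ∸ ∣ A ∣           ≡⟨ cong (λ c → ∣ W ─ A ∣ + c ∸ ∣ A ∣) ∣W∩A∣≡∣A∣ ⟨
    ∣ W ─ A ∣ + ∣ W ∩ A ∣ ∸ ∣ A ∣       ≡⟨ cong (_∸ ∣ A ∣) (∣p─q∣+∣p∩q∣≡∣p∣ W A) ⟩
    ∣ W ∣ ∸ ∣ A ∣                       ∎
    where
    open ≡-Reasoning
    ∣W∩A∣≡∣A∣ : ∣ W ∩ A ∣ ≡ ∣ A ∣
    ∣W∩A∣≡∣A∣ = cong ∣_∣ (⊆-antisym (p∩q⊆q W A) (λ x∈A → x∈p∩q⁺ (A⊆W x∈A , x∈A)))

  module _ {B : Subset n} (B⊆A : B ⊆ A) where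

    ∣W─A∪B∣≡∣W∣∸∣A∣+∣B∣ : ∣ (W ─ A) ∪ B ∣ ≡ ∣ W ∣ ∸ ∣ A ∣ + ∣ B ∣
    ∣W─A∪B∣≡∣W∣∸∣A∣+∣B∣ = begin
      ∣ (W ─ A) ∪ B ∣                           ≡⟨ +-identityʳ _ ⟨
      ∣ (W ─ A) ∪ B ∣ + 0                       ≡⟨ cong (∣ (W ─ A) ∪ B ∣ +_) disjoint ⟨
      ∣ (W ─ A) ∪ B ∣ + ∣ (W ─ A) ∩ B ∣         ≡⟨ ∣p∪q∣+∣p∩q∣≡∣p∣+∣q∣ (W ─ A) B ⟩
      ∣ W ─ A ∣ + ∣ B ∣                         ≡⟨ cong (_+ ∣ B ∣) ∣W─A∣≡∣W∣∸∣A∣ ⟩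
      ∣ W ∣ ∸ ∣ A ∣ + ∣ B ∣                     ∎
      where
      open ≡-Reasoning
      disjoint : ∣ (W ─ A) ∩ B ∣ ≡ 0
      disjoint = ∣Empty∣≡0 λ (_ , x∈) →
        let x∈W─A , x∈B = x∈p∩q⁻ (W ─ A) B x∈ in proj₂ (x∈p─q⁻ W A x∈W─A) (B⊆A x∈B)

    A∪W─A∪B≡W : A ∪ ((W ─ A) ∪ B) ≡ W
    A∪W─A∪B≡W = ⊆-antisym ⊆W W⊆
      where
      ⊆W : A ∪ ((W ─ A) ∪ B) ⊆ W
      ⊆W x∈ with x∈p∪q⁻ A _ x∈
      ... | inj₁ x∈A = A⊆W x∈A
      ... | inj₂ x∈W─A∪B with x∈p∪q⁻ (W ─ A) B x∈W─A∪B
      ...   | inj₁ x∈W─A = proj₁ (x∈p─q⁻ W A x∈W─A)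
      ...   | inj₂ x∈B   = A⊆W (B⊆A x∈B)
      W⊆ : W ⊆ A ∪ ((W ─ A) ∪ B)
      W⊆ {x} x∈W with x ∈? A
      ... | yes x∈A = x∈p∪q⁺ (inj₁ x∈A)
      ... | no  x∉A = x∈p∪q⁺ (inj₂ (x∈p∪q⁺ (inj₁ (x∈p∧x∉q⇒x∈p─q x∈W x∉A))))

nonemptyᵇ : ∀ {n} → Subset n → Bool
nonemptyᵇ []      = false
nonemptyᵇ (x ∷ p) = x ∨ nonemptyᵇ p

bit-nonemptyᵇ≤∣p∣ : ∀ {n} (p : Subset n) → bit (nonemptyᵇ p) ≤ ∣ p ∣
bit-nonemptyᵇ≤∣p∣ []          = z≤n
bit-nonemptyᵇ≤∣p∣ (true ∷ p)  = s≤s z≤n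
bit-nonemptyᵇ≤∣p∣ (false ∷ p) = bit-nonemptyᵇ≤∣p∣ p

nonemptyᵇ≡false⇒∣p∣≡0 : ∀ {n} (p : Subset n) → nonemptyᵇ p ≡ false → ∣ p ∣ ≡ 0
nonemptyᵇ≡false⇒∣p∣≡0 []          _     = refl
nonemptyᵇ≡false⇒∣p∣≡0 (false ∷ p) empty = nonemptyᵇ≡false⇒∣p∣≡0 p empty

replicate-+ : ∀ {A : Set} a b (x : A) → replicate (a + b) x ≡ replicate a x ++ replicate b x
replicate-+ zero    b x = refl
replicate-+ (suc a) b x = cong (x ∷_) (replicate-+ a b x)

nonemptyᵇ-⊤ : ∀ {m} → 1 ≤ m → nonemptyᵇ (⊤ {m}) ≡ true
nonemptyᵇ-⊤ (s≤s _) = refl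

take-++ : ∀ {A : Set} {m n} (u : Vec A m) (v : Vec A n) → take m (u ++ v) ≡ u
take-++ []      v = refl
take-++ (x ∷ u) v = cong (x ∷_) (take-++ u v)

drop-++ : ∀ {A : Set} {m n} (u : Vec A m) (v : Vec A n) → drop m (u ++ v) ≡ v
drop-++ []      v = refl
drop-++ (x ∷ u) v = drop-++ u v

-- Flats, cyclic flats and coloops of a matroid

a+b≤c+d∧c<a⇒b<d : ∀ {a b c d} → a + b ≤ c + d → c < a → b < d
a+b≤c+d∧c<a⇒b<d {a} {b} {c} {d} a+b≤c+d c<a = +-cancelˡ-≤ c (suc b) d (begin
  c + suc b  ≡⟨ +-suc c b ⟩
  suc c + b  ≤⟨ +-monoˡ-≤ b c<a ⟩
  a + b      ≤⟨ a+b≤c+d ⟩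
  c + d      ∎)
  where open ≤-Reasoning

module MatroidProperties {n : ℕ} (M : Matroid n) where

  r : Subset n → ℕ
  r = rank M

  r-mono : ∀ {X Y} → X ⊆ Y → r X ≤ r Y
  r-mono = rank-mono M _ _

  r-⊥ : r ⊥ ≡ 0
  r-⊥ = n≤0⇒n≡0 (≤-trans (rank-bound M ⊥) (≤-reflexive (∣⊥∣≡0 n)))

  r-submod⊆ : ∀ {U I} X Y → U ⊆ X ∪ Y → I ⊆ X ∩ Y → r U + r I ≤ r X + r Y
  r-submod⊆ X Y U⊆ I⊆ = ≤-trans (+-mono-≤ (r-mono U⊆) (r-mono I⊆)) (rank-submod M X Y)

  r-∪≤ : ∀ X Y → r (X ∪ Y) ≤ r X + r Y
  r-∪≤ X Y = ≤-trans (m≤m+n _ _) (rank-submod M X Y)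

  r≤r+∣─∣ : ∀ X Z → r X ≤ r Z + ∣ X ─ Z ∣
  r≤r+∣─∣ X Z = begin
    r X                  ≤⟨ r-mono X⊆Z∪X─Z ⟩
    r (Z ∪ (X ─ Z))      ≤⟨ r-∪≤ Z (X ─ Z) ⟩
    r Z + r (X ─ Z)      ≤⟨ +-monoʳ-≤ (r Z) (rank-bound M (X ─ Z)) ⟩
    r Z + ∣ X ─ Z ∣      ∎
    where
    open ≤-Reasoning
    X⊆Z∪X─Z : X ⊆ Z ∪ (X ─ Z)
    X⊆Z∪X─Z {x} x∈X with x ∈? Z
    ... | yes x∈Z = x∈p∪q⁺ (inj₁ x∈Z)
    ... | no  x∉Z = x∈p∪q⁺ (inj₂ (x∈p∧x∉q⇒x∈p─q x∈X x∉Z))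

  raises? : ∀ X e → Dec (e ∉ X → r X < r (X ∪ ⁅ e ⁆))
  raises? X e = ¬? (e ∈? X) →-dec (r X <? r (X ∪ ⁅ e ⁆))

  flat-or-extendable : ∀ X → IsFlat M X ⊎ ∃[ e ] (e ∉ X × r (X ∪ ⁅ e ⁆) ≡ r X)
  flat-or-extendable X with all? (raises? X)
  ... | yes flat = inj₁ flat
  ... | no ¬flat with ¬∀⟶∃¬ n _ (raises? X) ¬flat
  ...   | e , ¬raises = inj₂ (e , e∉X , ≤-antisym (≮⇒≥ r≮) (r-mono (p⊆p∪q ⁅ e ⁆)))
    where
    e∉X : e ∉ X
    e∉X e∈X = ¬raises λ e∉X → ⊥-elim (e∉X e∈X)
    r≮ : ¬ r X < r (X ∪ ⁅ e ⁆)
    r≮ r< = ¬raises λ _ → r<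

  closure : ∀ X → ∃[ F ] (IsFlat M F × X ⊆ F × r F ≡ r X)
  closure X = go n X (m≤n+m n ∣ X ∣)
    where
    go : ∀ d X → n ≤ ∣ X ∣ + d → ∃[ F ] (IsFlat M F × X ⊆ F × r F ≡ r X)
    go d X n≤ with flat-or-extendable X
    ... | inj₁ flat = X , flat , id , refl
    go zero X n≤ | inj₂ (e , e∉X , _) =
      ⊥-elim (<⇒≱ (≤-trans (∣p∣<∣p∪⁅x⁆∣ e∉X) (∣p∣≤n (X ∪ ⁅ e ⁆))) (≤-trans n≤ (≤-reflexive (+-identityʳ _))))
    go (suc d) X n≤ | inj₂ (e , e∉X , r≡)
      with go d (X ∪ ⁅ e ⁆) (≤-trans n≤ (≤-trans (≤-reflexive (+-suc _ d)) (+-monoˡ-≤ d (∣p∣<∣p∪⁅x⁆∣ e∉X))))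
    ... | F , flat , X∪e⊆F , rF≡ = F , flat , X∪e⊆F ∘ p⊆p∪q ⁅ e ⁆ , trans rF≡ r≡

  keeps? : ∀ Z e → Dec (e ∈ Z → r (Z - e) ≡ r Z)
  keeps? Z e = (e ∈? Z) →-dec (r (Z - e) ≟ r Z)

  cyclic-or-coloop : ∀ Z → IsCyclic M Z ⊎ ∃[ e ] IsColoopOf M Z e
  cyclic-or-coloop Z with all? (keeps? Z)
  ... | yes cyclic = inj₁ cyclic
  ... | no ¬cyclic with ¬∀⟶∃¬ n _ (keeps? Z) ¬cyclic
  ...   | e , ¬keeps = inj₂ (e , e∈Z , ≤∧≢⇒< (r-mono (p─q⊆p Z ⁅ e ⁆)) λ r≡ → ¬keeps λ _ → r≡)
    where
    e∈Z : e ∈ Z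
    e∈Z = decidable-stable (e ∈? Z) λ e∉Z → ¬keeps λ e∈Z → ⊥-elim (e∉Z e∈Z)

  coloop-of-subset : ∀ {W Y e} → Y ⊆ W → e ∈ Y → IsColoopOf M W e → IsColoopOf M Y e
  coloop-of-subset {W} {Y} {e} Y⊆W e∈Y (_ , r<) =
    e∈Y , a+b≤c+d∧c<a⇒b<d (r-submod⊆ (W - e) Y W⊆ Y-e⊆) r<
    where
    W⊆ : W ⊆ (W - e) ∪ Y
    W⊆ {x} x∈W with x ≟ᶠ e
    ... | yes refl = x∈p∪q⁺ (inj₂ e∈Y)
    ... | no  x≢e  = x∈p∪q⁺ (inj₁ (x∈p∧x∉q⇒x∈p─q x∈W (x≢y⇒x∉⁅y⁆ x≢e)))
    Y-e⊆ : Y - e ⊆ (W - e) ∩ Y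
    Y-e⊆ x∈ = let x∈Y , x∉e = x∈p─q⁻ Y ⁅ e ⁆ x∈ in x∈p∩q⁺ (x∈p∧x∉q⇒x∈p─q (Y⊆W x∈Y) x∉e , x∈Y)

  flat-minus-coloop : ∀ {Z e} → IsFlat M Z → IsColoopOf M Z e → IsFlat M (Z - e)
  flat-minus-coloop {Z} {e} flat (e∈Z , r<) f f∉Z-e with f ≟ᶠ e
  ... | yes refl = ≤-trans r< (r-mono Z⊆)
    where
    Z⊆ : Z ⊆ (Z - f) ∪ ⁅ f ⁆
    Z⊆ {x} x∈Z with x ≟ᶠ f
    ... | yes refl = x∈p∪q⁺ (inj₂ (x∈⁅x⁆ x))
    ... | no  x≢f  = x∈p∪q⁺ (inj₁ (x∈p∧x∉q⇒x∈p─q x∈Z (x≢y⇒x∉⁅y⁆ x≢f)))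
  ... | no f≢e = a+b≤c+d∧c<a⇒b<d (r-submod⊆ Z ((Z - e) ∪ ⁅ f ⁆) Z∪f⊆ Z-e⊆) (flat f f∉Z)
    where
    f∉Z : f ∉ Z
    f∉Z f∈Z = f∉Z-e (x∈p∧x∉q⇒x∈p─q f∈Z (x≢y⇒x∉⁅y⁆ f≢e))
    Z∪f⊆ : Z ∪ ⁅ f ⁆ ⊆ Z ∪ ((Z - e) ∪ ⁅ f ⁆)
    Z∪f⊆ x∈ with x∈p∪q⁻ Z ⁅ f ⁆ x∈
    ... | inj₁ x∈Z = x∈p∪q⁺ (inj₁ x∈Z)
    ... | inj₂ x≡f = x∈p∪q⁺ (inj₂ (x∈p∪q⁺ (inj₂ x≡f)))
    Z-e⊆ : Z - e ⊆ Z ∩ ((Z - e) ∪ ⁅ f ⁆)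
    Z-e⊆ x∈ = x∈p∩q⁺ (p─q⊆p Z ⁅ e ⁆ x∈ , x∈p∪q⁺ (inj₁ x∈))

  -- Removing a coloop from a flat keeps it flat and does not increase r Z + ∣ X ─ Z ∣.
  remove-coloops : ∀ X {Z} → IsFlat M Z →
                   ∃[ Z′ ] (IsCyclicFlat M Z′ × r Z′ + ∣ X ─ Z′ ∣ ≤ r Z + ∣ X ─ Z ∣)
  remove-coloops X {Z} = go ∣ Z ∣ Z ≤-refl
    where
    go : ∀ d Z → ∣ Z ∣ ≤ d → IsFlat M Z →
         ∃[ Z′ ] (IsCyclicFlat M Z′ × r Z′ + ∣ X ─ Z′ ∣ ≤ r Z + ∣ X ─ Z ∣)
    go d Z ∣Z∣≤d flat with cyclic-or-coloop Z
    ... | inj₁ cyclic = Z , (flat , cyclic) , ≤-refl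
    go zero Z ∣Z∣≤d flat | inj₂ (e , e∈Z , _) =
      ⊥-elim (<⇒≱ (≤-trans (x∈p⇒∣p-x∣<∣p∣ e∈Z) ∣Z∣≤d) z≤n)
    go (suc d) Z ∣Z∣≤d flat | inj₂ (e , coloop@(e∈Z , r<))
      with go d (Z - e) (≤-pred (≤-trans (x∈p⇒∣p-x∣<∣p∣ e∈Z) ∣Z∣≤d)) (flat-minus-coloop flat coloop)
    ... | Z′ , cyclicFlat , ≤Z-e = Z′ , cyclicFlat , (begin
          r Z′ + ∣ X ─ Z′ ∣                ≤⟨ ≤Z-e ⟩
          r (Z - e) + ∣ X ─ (Z - e) ∣      ≤⟨ +-monoʳ-≤ (r (Z - e)) (∣X─[Z-e]∣≤1+∣X─Z∣ X Z e) ⟩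
          r (Z - e) + suc ∣ X ─ Z ∣        ≡⟨ +-suc _ _ ⟩
          suc (r (Z - e)) + ∣ X ─ Z ∣      ≤⟨ +-monoˡ-≤ _ r< ⟩
          r Z + ∣ X ─ Z ∣                  ∎)
      where open ≤-Reasoning

  -- Half of the formula r X = min { r Z + ∣ X ─ Z ∣ : Z cyclic flat }.
  cyclicFlat-below : ∀ X → ∃[ Z ] (IsCyclicFlat M Z × r Z + ∣ X ─ Z ∣ ≤ r X)
  cyclicFlat-below X with closure X
  ... | F , flat , X⊆F , rF≡ with remove-coloops X flat
  ...   | Z , cyclicFlat , ≤F = Z , cyclicFlat , (begin
          r Z + ∣ X ─ Z ∣   ≤⟨ ≤F ⟩
          r F + ∣ X ─ F ∣   ≡⟨ cong₂ _+_ rF≡ (∣Empty∣≡0 X─F-empty) ⟩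
          r X + 0           ≡⟨ +-identityʳ _ ⟩
          r X               ∎)
    where
    open ≤-Reasoning
    X─F-empty : Empty (X ─ F)
    X─F-empty (_ , x∈) = let x∈X , x∉F = x∈p─q⁻ X F x∈ in x∉F (X⊆F x∈X)

  isColoopᵇ : Subset n → Fin n → Bool
  isColoopᵇ W e = lookup W e ∧ (r (W - e) <ᵇ r W)

  coloopSet : Subset n → Subset n
  coloopSet W = tabulate (isColoopᵇ W)

  coloops≡∣coloopSet∣ : ∀ W → coloops M W ≡ ∣ coloopSet W ∣
  coloops≡∣coloopSet∣ W =
    trans (cong sum (List.map-tabulate id λ e → if isColoopᵇ W e then 1 else 0)) (sym (∣tabulate∣ (isColoopᵇ W)))

  ∈coloopSet⇔ : ∀ {W e} → e ∈ coloopSet W ⇔ IsColoopOf M W e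
  ∈coloopSet⇔ {W} {e} = mk⇔ to from
    where
    to : e ∈ coloopSet W → IsColoopOf M W e
    to e∈ with Equivalence.to Bool.T-∧ (subst T (lookup∘tabulate _ e) (Equivalence.to ∈⇔T-lookup e∈))
    ... | e∈W , r<ᵇ = Equivalence.from ∈⇔T-lookup e∈W , <ᵇ⇒< _ _ r<ᵇ
    from : IsColoopOf M W e → e ∈ coloopSet W
    from (e∈W , r<) = Equivalence.from ∈⇔T-lookup (subst T (sym (lookup∘tabulate _ e))
      (Equivalence.from Bool.T-∧ (Equivalence.to ∈⇔T-lookup e∈W , <⇒<ᵇ r<)))

  coloopSet⊆ : ∀ W → coloopSet W ⊆ W
  coloopSet⊆ W e∈ = proj₁ (Equivalence.to ∈coloopSet⇔ e∈)

  spanning⇒coloop : ∀ {A W e} → r A + ∣ W ─ A ∣ ≡ r W → e ∈ W ─ A → IsColoopOf M W e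
  spanning⇒coloop {A} {W} {e} spanning e∈W─A = proj₁ (x∈p─q⁻ W A e∈W─A) , (begin-strict
    r (W - e)                      ≤⟨ r≤r+∣─∣ (W - e) A ⟩
    r A + ∣ (W - e) ─ A ∣          ≡⟨ cong (λ D → r A + ∣ D ∣) (p─q─r≡p─r─q W ⁅ e ⁆ A) ⟩
    r A + ∣ (W ─ A) - e ∣          <⟨ +-monoʳ-< (r A) (x∈p⇒∣p-x∣<∣p∣ e∈W─A) ⟩
    r A + ∣ W ─ A ∣                ≡⟨ spanning ⟩
    r W                            ∎)
    where open ≤-Reasoning

  coloops⇒spanning : ∀ {A W} → A ⊆ W → (∀ {e} → e ∈ W ─ A → IsColoopOf M W e) → r A + ∣ W ─ A ∣ ≤ r W
  coloops⇒spanning {A} = go _ refl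
    where
    go : ∀ d {W} → ∣ W ─ A ∣ ≡ d → A ⊆ W → (∀ {e} → e ∈ W ─ A → IsColoopOf M W e) → r A + d ≤ r W
    go d {W} ∣W─A∣≡d A⊆W coloop with nonempty? (W ─ A)
    ... | no empty = begin
      r A + d          ≡⟨ cong (r A +_) (trans (sym ∣W─A∣≡d) (∣Empty∣≡0 empty)) ⟩
      r A + 0          ≡⟨ +-identityʳ _ ⟩
      r A              ≤⟨ r-mono A⊆W ⟩
      r W              ∎
      where open ≤-Reasoning
    go zero {W} ∣W─A∣≡0 A⊆W coloop | yes (e , e∈W─A) =
      ⊥-elim (0≢1+n (trans (sym ∣W─A∣≡0) (∣p∣≡1+∣p-x∣ e∈W─A)))
    go (suc d) {W} ∣W─A∣≡1+d A⊆W coloop | yes (e , e∈W─A) = begin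
      r A + suc d          ≡⟨ +-suc (r A) d ⟩
      suc (r A + d)        ≤⟨ s≤s (go d ∣W-e─A∣≡d A⊆W-e coloop′) ⟩
      suc (r (W - e))      ≤⟨ proj₂ (coloop e∈W─A) ⟩
      r W                  ∎
      where
      open ≤-Reasoning
      ∣W-e─A∣≡d : ∣ (W - e) ─ A ∣ ≡ d
      ∣W-e─A∣≡d = suc-injective (begin-equality
        suc ∣ (W - e) ─ A ∣    ≡⟨ cong (λ D → suc ∣ D ∣) (p─q─r≡p─r─q W ⁅ e ⁆ A) ⟩
        suc ∣ (W ─ A) - e ∣    ≡⟨ ∣p∣≡1+∣p-x∣ e∈W─A ⟨
        ∣ W ─ A ∣              ≡⟨ ∣W─A∣≡1+d ⟩
        suc d                  ∎)
      A⊆W-e : A ⊆ W - e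
      A⊆W-e x∈A = x∈p∧x∉q⇒x∈p─q (A⊆W x∈A)
        λ x∈⁅e⁆ → proj₂ (x∈p─q⁻ W A e∈W─A) (subst (_∈ A) (x∈⁅y⁆⇒x≡y e x∈⁅e⁆) x∈A)
      coloop′ : ∀ {f} → f ∈ (W - e) ─ A → IsColoopOf M (W - e) f
      coloop′ {f} f∈ = let f∈W-e , f∉A = x∈p─q⁻ (W - e) A f∈ in
        coloop-of-subset (p─q⊆p W ⁅ e ⁆) f∈W-e (coloop (x∈p∧x∉q⇒x∈p─q (p─q⊆p W ⁅ e ⁆ f∈W-e) f∉A))

  spanning⇔⊆coloopSet : ∀ {A W} → A ⊆ W → (r A + ∣ W ─ A ∣ ≡ r W) ⇔ (W ─ A ⊆ coloopSet W)
  spanning⇔⊆coloopSet {A} {W} A⊆W = mk⇔ to from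
    where
    to : r A + ∣ W ─ A ∣ ≡ r W → W ─ A ⊆ coloopSet W
    to spanning e∈ = Equivalence.from ∈coloopSet⇔ (spanning⇒coloop spanning e∈)
    from : W ─ A ⊆ coloopSet W → r A + ∣ W ─ A ∣ ≡ r W
    from ⊆C = ≤-antisym (coloops⇒spanning A⊆W (Equivalence.to ∈coloopSet⇔ ∘ ⊆C)) (r≤r+∣─∣ W A)

-- The rank function of a free cone

module Blocks (m : ℕ) where

  blocks : ∀ {n} → Subset n → Subset (n * m)
  blocks F = concat (map (replicate m) F)

  support : ∀ n → Subset (n * m) → Subset n
  support zero    Y = []
  support (suc n) Y = nonemptyᵇ (take m Y) ∷ support n (drop m Y)

  support-++ : ∀ {n} (u : Subset m) (v : Subset (n * m)) → support (suc n) (u ++ v) ≡ nonemptyᵇ u ∷ support n v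
  support-++ u v = cong₂ (λ u v → nonemptyᵇ u ∷ support _ v) (take-++ u v) (drop-++ u v)

  support-⊤ : 1 ≤ m → ∀ n → support n ⊤ ≡ ⊤
  support-⊤ 1≤m zero    = refl
  support-⊤ 1≤m (suc n) = begin
    support (suc n) ⊤                      ≡⟨ cong (support (suc n)) (replicate-+ m (n * m) true) ⟩
    support (suc n) (⊤ {m} ++ ⊤ {n * m})   ≡⟨ support-++ {n} ⊤ ⊤ ⟩
    nonemptyᵇ (⊤ {m}) ∷ support n ⊤        ≡⟨ cong₂ _∷_ (nonemptyᵇ-⊤ 1≤m) (support-⊤ 1≤m n) ⟩
    ⊤                                      ∎
    where open ≡-Reasoning

  blocks-⊥ : ∀ n → blocks (⊥ {n}) ≡ ⊥
  blocks-⊥ zero    = refl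
  blocks-⊥ (suc n) = trans (cong (replicate m false ++_) (blocks-⊥ n)) (sym (replicate-+ m (n * m) false))

  ∣support─F∣≤∣Y─blocksF∣ : ∀ {n} (Y : Subset (n * m)) F → ∣ support n Y ─ F ∣ ≤ ∣ Y ─ blocks F ∣
  ∣support─F∣≤∣Y─blocksF∣ {zero}  Y       []      = z≤n
  ∣support─F∣≤∣Y─blocksF∣ {suc n} Y       (f ∷ F) with splitAt m Y
  ∣support─F∣≤∣Y─blocksF∣ {suc n} .(u ++ v) (f ∷ F) | u , v , refl
    rewrite ∣p++q─p′++q′∣ u (replicate m f) v (blocks F) with f
  ... | true  = ≤-trans (∣support─F∣≤∣Y─blocksF∣ {n} v F) (m≤n+m _ _)
  ... | false = begin
    ∣ nonemptyᵇ u ∷ (support n v ─ F) ∣          ≡⟨ ∣x∷p∣ (nonemptyᵇ u) (support n v ─ F) ⟩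
    bit (nonemptyᵇ u) + ∣ support n v ─ F ∣       ≤⟨ +-mono-≤ (bit-nonemptyᵇ≤∣p∣ u) (∣support─F∣≤∣Y─blocksF∣ {n} v F) ⟩
    ∣ u ∣ + ∣ v ─ blocks F ∣                      ≡⟨ cong (λ u → ∣ u ∣ + _) (p─⊥≡p u) ⟨
    ∣ u ─ ⊥ ∣ + ∣ v ─ blocks F ∣                  ∎
    where open ≤-Reasoning

  ∣support─F∣≡0⇒∣Y─blocksF∣≡0 : ∀ {n} (Y : Subset (n * m)) F → ∣ support n Y ─ F ∣ ≡ 0 → ∣ Y ─ blocks F ∣ ≡ 0
  ∣support─F∣≡0⇒∣Y─blocksF∣≡0 {zero}  []      []      _ = refl
  ∣support─F∣≡0⇒∣Y─blocksF∣≡0 {suc n} Y       (f ∷ F) with splitAt m Y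
  ∣support─F∣≡0⇒∣Y─blocksF∣≡0 {suc n} .(u ++ v) (f ∷ F) | u , v , refl
    rewrite ∣p++q─p′++q′∣ u (replicate m f) v (blocks F) with f
  ... | true  = λ ∣s─F∣≡0 →
    cong₂ _+_ (trans (cong ∣_∣ (p─⊤≡⊥ u)) (∣⊥∣≡0 m)) (∣support─F∣≡0⇒∣Y─blocksF∣≡0 {n} v F ∣s─F∣≡0)
  ... | false = λ ∣s─F∣≡0 → let sum≡0 = trans (sym (∣x∷p∣ (nonemptyᵇ u) (support n v ─ F))) ∣s─F∣≡0 in
    cong₂ _+_ (trans (cong ∣_∣ (p─⊥≡p u)) (nonemptyᵇ≡false⇒∣p∣≡0 u (bit≡0 (m+n≡0⇒m≡0 _ sum≡0))))
              (∣support─F∣≡0⇒∣Y─blocksF∣≡0 {n} v F (m+n≡0⇒n≡0 _ sum≡0))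
    where
    bit≡0 : ∀ {b} → bit b ≡ 0 → b ≡ false
    bit≡0 {false} _ = refl

-- A subset of E(Q) is written α ∷ (A ++ Y) with α the tip bit, A ⊆ E and Y ⊆ T.
module ConeRank (m : ℕ) {n : ℕ} (M : Matroid n) (Q : Matroid (ConeSize n m)) (cone : IsFreeCone m M Q) where

  open Blocks m
  open MatroidProperties M using (r; r≤r+∣─∣; closure; cyclicFlat-below)
  module QP = MatroidProperties Q

  rQ : Subset (ConeSize n m) → ℕ
  rQ = rank Q

  private
    cyclicFlats-Q : ∀ Z → IsCyclicFlat Q Z ⇔
      ((∃[ Z′ ] (IsCyclicFlat M Z′ × Z ≡ embE m Z′)) ⊎ (∃[ F ] (IsFlat M F × Nonempty F × Z ≡ qSet m F)))
    cyclicFlats-Q = proj₁ cone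
    rQ-embE : ∀ Z → IsCyclicFlat M Z → rQ (embE m Z) ≡ r Z
    rQ-embE = proj₁ (proj₂ cone)
    rQ-qSet : ∀ F → IsFlat M F → Nonempty F → rQ (qSet m F) ≡ suc (r F)
    rQ-qSet = proj₂ (proj₂ cone)

  coneRank : Bool → Subset n → Subset (n * m) → ℕ
  coneRank α A Y = (r A + bit α + ∣ Y ∣) ⊓ suc (r (A ∪ support n Y))

  ∣X─embE∣ : ∀ α (A Z : Subset n) (Y : Subset (n * m)) → ∣ (α ∷ (A ++ Y)) ─ embE m Z ∣ ≡ bit α + (∣ A ─ Z ∣ + ∣ Y ∣)
  ∣X─embE∣ α A Z Y = begin
    ∣ α ∷ ((A ++ Y) ─ (Z ++ ⊥)) ∣       ≡⟨ ∣x∷p∣ α ((A ++ Y) ─ (Z ++ ⊥)) ⟩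
    bit α + ∣ (A ++ Y) ─ (Z ++ ⊥) ∣     ≡⟨ cong (bit α +_) (∣p++q─p′++q′∣ A Z Y ⊥) ⟩
    bit α + (∣ A ─ Z ∣ + ∣ Y ─ ⊥ ∣)     ≡⟨ cong (λ Y → bit α + (∣ A ─ Z ∣ + ∣ Y ∣)) (p─⊥≡p Y) ⟩
    bit α + (∣ A ─ Z ∣ + ∣ Y ∣)         ∎
    where open ≡-Reasoning

  ∣X─qSet∣ : ∀ α (A F : Subset n) (Y : Subset (n * m)) → ∣ (α ∷ (A ++ Y)) ─ qSet m F ∣ ≡ ∣ A ─ F ∣ + ∣ Y ─ blocks F ∣
  ∣X─qSet∣ α A F Y = ∣p++q─p′++q′∣ A F Y (blocks F)

  +-rearrange : ∀ a b c d → a + b + c + d ≡ a + (c + (b + d))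
  +-rearrange = solve-∀ℕ

  coneRank≤rQ : ∀ α A Y → coneRank α A Y ≤ rQ (α ∷ (A ++ Y))
  coneRank≤rQ α A Y with QP.cyclicFlat-below (α ∷ (A ++ Y))
  ... | Z , cyclicFlat , ≤rQ with Equivalence.to (cyclicFlats-Q Z) cyclicFlat
  ... | inj₁ (Z′ , cyclicFlat′ , refl) = ≤-trans (m⊓n≤m _ _) (begin
    r A + bit α + ∣ Y ∣                                  ≤⟨ +-monoˡ-≤ ∣ Y ∣ (+-monoˡ-≤ (bit α) (r≤r+∣─∣ A Z′)) ⟩
    r Z′ + ∣ A ─ Z′ ∣ + bit α + ∣ Y ∣                    ≡⟨ +-rearrange (r Z′) _ _ _ ⟩
    r Z′ + (bit α + (∣ A ─ Z′ ∣ + ∣ Y ∣))                ≡⟨ cong₂ _+_ (rQ-embE Z′ cyclicFlat′) (∣X─embE∣ α A Z′ Y) ⟨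
    rQ (embE m Z′) + ∣ (α ∷ (A ++ Y)) ─ embE m Z′ ∣      ≤⟨ ≤rQ ⟩
    rQ (α ∷ (A ++ Y))                                    ∎)
    where open ≤-Reasoning
  ... | inj₂ (F , flat , nonempty , refl) = ≤-trans (m⊓n≤n _ _) (begin
    suc (r (A ∪ S))                                      ≤⟨ s≤s (r≤r+∣─∣ (A ∪ S) F) ⟩
    suc (r F + ∣ (A ∪ S) ─ F ∣)                          ≤⟨ s≤s (+-monoʳ-≤ (r F) ∣A∪S─F∣≤) ⟩
    suc (r F) + (∣ A ─ F ∣ + ∣ Y ─ blocks F ∣)           ≡⟨ cong₂ _+_ (rQ-qSet F flat nonempty) (∣X─qSet∣ α A F Y) ⟨
    rQ (qSet m F) + ∣ (α ∷ (A ++ Y)) ─ qSet m F ∣        ≤⟨ ≤rQ ⟩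
    rQ (α ∷ (A ++ Y))                                    ∎)
    where
    open ≤-Reasoning
    S : Subset n
    S = support n Y
    ∣A∪S─F∣≤ : ∣ (A ∪ S) ─ F ∣ ≤ ∣ A ─ F ∣ + ∣ Y ─ blocks F ∣
    ∣A∪S─F∣≤ = ≤-trans (∣[p∪q]─r∣≤∣p─r∣+∣q─r∣ A S F) (+-monoʳ-≤ ∣ A ─ F ∣ (∣support─F∣≤∣Y─blocksF∣ Y F))

  rQ≤r[A]+α+∣Y∣ : ∀ α A Y → rQ (α ∷ (A ++ Y)) ≤ r A + bit α + ∣ Y ∣
  rQ≤r[A]+α+∣Y∣ α A Y with cyclicFlat-below A
  ... | Z , cyclicFlat , ≤rA = begin
    rQ (α ∷ (A ++ Y))                                    ≤⟨ QP.r≤r+∣─∣ (α ∷ (A ++ Y)) (embE m Z) ⟩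
    rQ (embE m Z) + ∣ (α ∷ (A ++ Y)) ─ embE m Z ∣        ≡⟨ cong₂ _+_ (rQ-embE Z cyclicFlat) (∣X─embE∣ α A Z Y) ⟩
    r Z + (bit α + (∣ A ─ Z ∣ + ∣ Y ∣))                  ≡⟨ +-rearrange (r Z) _ _ _ ⟨
    r Z + ∣ A ─ Z ∣ + bit α + ∣ Y ∣                      ≤⟨ +-monoˡ-≤ ∣ Y ∣ (+-monoˡ-≤ (bit α) ≤rA) ⟩
    r A + bit α + ∣ Y ∣                                  ∎
    where open ≤-Reasoning

  rQ≤1+r[A∪support] : ∀ α A Y → rQ (α ∷ (A ++ Y)) ≤ suc (r (A ∪ support n Y))
  rQ≤1+r[A∪support] α A Y with nonempty? (A ∪ support n Y)
  ... | yes (e , e∈A∪S) with closure (A ∪ support n Y)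
  ...   | F , flat , A∪S⊆F , rF≡ = begin
    rQ (α ∷ (A ++ Y))                                    ≤⟨ QP.r≤r+∣─∣ (α ∷ (A ++ Y)) (qSet m F) ⟩
    rQ (qSet m F) + ∣ (α ∷ (A ++ Y)) ─ qSet m F ∣        ≡⟨ cong₂ _+_ (rQ-qSet F flat (e , A∪S⊆F e∈A∪S)) (∣X─qSet∣ α A F Y) ⟩
    suc (r F) + (∣ A ─ F ∣ + ∣ Y ─ blocks F ∣)           ≡⟨ cong₂ (λ a b → suc a + b) rF≡ (cong₂ _+_ ∣A─F∣≡0 ∣Y─F∣≡0) ⟩
    suc (r (A ∪ support n Y)) + 0                        ≡⟨ +-identityʳ _ ⟩
    suc (r (A ∪ support n Y))                            ∎
    where
    open ≤-Reasoning
    ∣A─F∣≡0 : ∣ A ─ F ∣ ≡ 0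
    ∣A─F∣≡0 = ∣Empty∣≡0 λ (_ , x∈) → let x∈A , x∉F = x∈p─q⁻ A F x∈ in x∉F (A∪S⊆F (x∈p∪q⁺ (inj₁ x∈A)))
    ∣Y─F∣≡0 : ∣ Y ─ blocks F ∣ ≡ 0
    ∣Y─F∣≡0 = ∣support─F∣≡0⇒∣Y─blocksF∣≡0 Y F (∣Empty∣≡0 λ (_ , x∈) →
      let x∈S , x∉F = x∈p─q⁻ (support n Y) F x∈ in x∉F (A∪S⊆F (x∈p∪q⁺ (inj₂ x∈S))))
  rQ≤1+r[A∪support] α A Y | no empty = begin
    rQ (α ∷ (A ++ Y))               ≤⟨ rank-bound Q (α ∷ (A ++ Y)) ⟩
    ∣ α ∷ (A ++ Y) ∣                ≡⟨ trans (∣x∷p∣ α (A ++ Y)) (cong (bit α +_) (∣p++q∣ A Y)) ⟩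
    bit α + (∣ A ∣ + ∣ Y ∣)          ≡⟨ cong (λ k → bit α + k) (cong₂ _+_ ∣A∣≡0 ∣Y∣≡0) ⟩
    bit α + 0                       ≤⟨ +-monoˡ-≤ 0 (bit≤1 α) ⟩
    1                               ≤⟨ s≤s z≤n ⟩
    suc (r (A ∪ support n Y))       ∎
    where
    open ≤-Reasoning
    ∣A∪S∣≡0 : ∣ A ∪ support n Y ∣ ≡ 0
    ∣A∪S∣≡0 = ∣Empty∣≡0 empty
    ∣A∣≡0 : ∣ A ∣ ≡ 0
    ∣A∣≡0 = n≤0⇒n≡0 (≤-trans (∣p∣≤∣p∪q∣ A (support n Y)) (≤-reflexive ∣A∪S∣≡0))
    ∣Y∣≡0 : ∣ Y ∣ ≡ 0
    ∣Y∣≡0 = begin-equality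
      ∣ Y ∣                          ≡⟨ cong ∣_∣ (p─⊥≡p Y) ⟨
      ∣ Y ─ ⊥ ∣                      ≡⟨ cong (λ B → ∣ Y ─ B ∣) (blocks-⊥ n) ⟨
      ∣ Y ─ blocks (⊥ {n}) ∣         ≡⟨ ∣support─F∣≡0⇒∣Y─blocksF∣≡0 {n} Y ⊥ (trans (cong ∣_∣ (p─⊥≡p (support n Y)))
                                          (n≤0⇒n≡0 (≤-trans (∣q∣≤∣p∪q∣ A (support n Y)) (≤-reflexive ∣A∪S∣≡0)))) ⟩
      0                              ∎

  rank-cone : ∀ α A Y → rQ (α ∷ (A ++ Y)) ≡ coneRank α A Y
  rank-cone α A Y = ≤-antisym (⊓-glb (rQ≤r[A]+α+∣Y∣ α A Y) (rQ≤1+r[A∪support] α A Y)) (coneRank≤rQ α A Y)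

-- Sums over enumerations of subsets

private variable
  A B : Set

∑ : List A → (A → ℤ) → ℤ
∑ xs f = List.foldr _+ℤ_ 0ℤ (List.map f xs)

syntax ∑ xs (λ x → e) = ∑[ x ∈ xs ] e

∑-0 : ∀ (xs : List A) → ∑[ x ∈ xs ] 0ℤ ≡ 0ℤ
∑-0 List.[]       = refl
∑-0 (x List.∷ xs) = trans (ℤ.+-identityˡ _) (∑-0 xs)

∑-++ : ∀ (xs ys : List A) f → ∑ (xs List.++ ys) f ≡ ∑ xs f +ℤ ∑ ys f
∑-++ List.[]       ys f = sym (ℤ.+-identityˡ _)
∑-++ (x List.∷ xs) ys f = trans (cong (f x +ℤ_) (∑-++ xs ys f)) (sym (ℤ.+-assoc (f x) _ _))

∑-map : ∀ (g : A → B) xs f → ∑ (List.map g xs) f ≡ ∑ xs (f ∘ g)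
∑-map g List.[]       f = refl
∑-map g (x List.∷ xs) f = cong (f (g x) +ℤ_) (∑-map g xs f)

∑-congᴬ : ∀ {P : A → Set} {xs f g} → All P xs → (∀ {x} → P x → f x ≡ g x) → ∑ xs f ≡ ∑ xs g
∑-congᴬ All.[]         f≡g = refl
∑-congᴬ (px All.∷ pxs) f≡g = cong₂ _+ℤ_ (f≡g px) (∑-congᴬ pxs f≡g)

∑-cong : ∀ (xs : List A) {f g : A → ℤ} → (∀ x → f x ≡ g x) → ∑ xs f ≡ ∑ xs g
∑-cong List.[]       f≡g = refl
∑-cong (x List.∷ xs) f≡g = cong₂ _+ℤ_ (f≡g x) (∑-cong xs f≡g)

∑-+ : ∀ (xs : List A) (f g : A → ℤ) → ∑[ x ∈ xs ] (f x +ℤ g x) ≡ ∑ xs f +ℤ ∑ xs g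
∑-+ List.[]       f g = refl
∑-+ (x List.∷ xs) f g = trans (cong (f x +ℤ g x +ℤ_) (∑-+ xs f g)) (ℤ+.interchange (f x) (g x) _ _)

∑-comm : ∀ (xs : List A) (ys : List B) (f : A → B → ℤ) →
         ∑[ a ∈ xs ] ∑[ b ∈ ys ] f a b ≡ ∑[ b ∈ ys ] ∑[ a ∈ xs ] f a b
∑-comm List.[]       ys f = sym (∑-0 ys)
∑-comm (x List.∷ xs) ys f = trans (cong (∑ ys (f x) +ℤ_) (∑-comm xs ys f)) (sym (∑-+ ys (f x) _))

∑-concatMap : ∀ (g : A → List B) xs f → ∑ (List.concatMap g xs) f ≡ ∑[ a ∈ xs ] ∑ (g a) f
∑-concatMap g List.[]       f = refl
∑-concatMap g (x List.∷ xs) f = trans (∑-++ (g x) _ f) (cong (∑ (g x) f +ℤ_) (∑-concatMap g xs f))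

∑-↭ : ∀ {xs ys : List A} → xs ↭ ys → ∀ f → ∑ xs f ≡ ∑ ys f
∑-↭ xs↭ys f = foldr-commMonoid (ℤ.≡-setoid) ℤ.+-0-isCommutativeMonoid (↭⇒↭ₛ (↭.map⁺ f xs↭ys))

∑-[x] : ∀ (x : A) f → ∑ [ x ] f ≡ f x
∑-[x] x f = ℤ.+-identityʳ (f x)

∑-split : ∀ {k} (xs : List (Subset k)) h →
          ∑ (List.map (true ∷_) xs List.++ List.map (false ∷_) xs) h ≡
          ∑[ u ∈ xs ] h (true ∷ u) +ℤ ∑[ u ∈ xs ] h (false ∷ u)
∑-split xs h = trans (∑-++ (List.map (true ∷_) xs) _ h) (cong₂ _+ℤ_ (∑-map (true ∷_) xs h) (∑-map (false ∷_) xs h))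

subsetsOf-⊤ : ∀ k → subsetsOf (⊤ {k}) ≡ allSubsets k
subsetsOf-⊤ zero    = refl
subsetsOf-⊤ (suc k) = cong (λ xs → List.map (true ∷_) xs List.++ List.map (false ∷_) xs) (subsetsOf-⊤ k)

subsetsOf-⊥ : ∀ k → subsetsOf (⊥ {k}) ≡ [ ⊥ ]
subsetsOf-⊥ zero    = refl
subsetsOf-⊥ (suc k) = cong (List.map (false ∷_)) (subsetsOf-⊥ k)

subsetsOf-⊆ : ∀ {k} (C : Subset k) → All (_⊆ C) (subsetsOf C)
subsetsOf-⊆ []          = (λ ()) All.∷ All.[]
subsetsOf-⊆ (true ∷ C)  = All.++⁺ (All.map⁺ (All.map in⊆in (subsetsOf-⊆ C))) (All.map⁺ (All.map out⊆ (subsetsOf-⊆ C)))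
subsetsOf-⊆ (false ∷ C) = All.map⁺ (All.map out⊆ (subsetsOf-⊆ C))

∑-subsetsOf-++ : ∀ {a b} (u : Subset a) (v : Subset b) f →
                 ∑ (subsetsOf (u ++ v)) f ≡ ∑[ A ∈ subsetsOf u ] ∑[ Y ∈ subsetsOf v ] f (A ++ Y)
∑-subsetsOf-++ []          v f = sym (∑-[x] [] λ A → ∑[ Y ∈ subsetsOf v ] f (A ++ Y))
∑-subsetsOf-++ (true ∷ u)  v f = begin
  ∑ (subsetsOf (true ∷ (u ++ v))) f
    ≡⟨ ∑-split (subsetsOf (u ++ v)) f ⟩
  ∑ (subsetsOf (u ++ v)) (f ∘ (true ∷_)) +ℤ ∑ (subsetsOf (u ++ v)) (f ∘ (false ∷_))
    ≡⟨ cong₂ _+ℤ_ (∑-subsetsOf-++ u v (f ∘ (true ∷_))) (∑-subsetsOf-++ u v (f ∘ (false ∷_))) ⟩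
  _
    ≡⟨ ∑-split (subsetsOf u) (λ A → ∑[ Y ∈ subsetsOf v ] f (A ++ Y)) ⟨
  ∑[ A ∈ subsetsOf (true ∷ u) ] ∑[ Y ∈ subsetsOf v ] f (A ++ Y) ∎
  where open ≡-Reasoning
∑-subsetsOf-++ (false ∷ u) v f = begin
  ∑ (subsetsOf (false ∷ (u ++ v))) f                               ≡⟨ ∑-map (false ∷_) (subsetsOf (u ++ v)) f ⟩
  ∑ (subsetsOf (u ++ v)) (f ∘ (false ∷_))                           ≡⟨ ∑-subsetsOf-++ u v (f ∘ (false ∷_)) ⟩
  _                                                                 ≡⟨ ∑-map (false ∷_) (subsetsOf u) _ ⟨
  ∑[ A ∈ subsetsOf (false ∷ u) ] ∑[ Y ∈ subsetsOf v ] f (A ++ Y)   ∎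
  where open ≡-Reasoning

∑-allSubsets-+ : ∀ a b f → ∑ (allSubsets (a + b)) f ≡ ∑[ u ∈ allSubsets a ] ∑[ v ∈ allSubsets b ] f (u ++ v)
∑-allSubsets-+ a b f = begin
  ∑ (allSubsets (a + b)) f
    ≡⟨ cong (λ xs → ∑ xs f) (subsetsOf-⊤ (a + b)) ⟨
  ∑ (subsetsOf (⊤ {a + b})) f
    ≡⟨ cong (λ X → ∑ (subsetsOf X) f) (replicate-+ a b true) ⟩
  ∑ (subsetsOf (⊤ {a} ++ ⊤ {b})) f
    ≡⟨ ∑-subsetsOf-++ (⊤ {a}) (⊤ {b}) f ⟩
  ∑[ u ∈ subsetsOf (⊤ {a}) ] ∑[ v ∈ subsetsOf (⊤ {b}) ] f (u ++ v)
    ≡⟨ cong₂ (λ us vs → ∑[ u ∈ us ] ∑[ v ∈ vs ] f (u ++ v)) (subsetsOf-⊤ a) (subsetsOf-⊤ b) ⟩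
  ∑[ u ∈ allSubsets a ] ∑[ v ∈ allSubsets b ] f (u ++ v) ∎
  where open ≡-Reasoning

∑-subsetsOf-by-size : ∀ {k} (C : Subset k) (g : ℕ → ℤ) →
                      ∑[ D ∈ subsetsOf C ] g ∣ D ∣ ≡ ∑[ D ∈ allSubsets ∣ C ∣ ] g ∣ D ∣
∑-subsetsOf-by-size []          g = refl
∑-subsetsOf-by-size (true ∷ C)  g = begin
  ∑[ D ∈ subsetsOf (true ∷ C) ] g ∣ D ∣
    ≡⟨ ∑-split (subsetsOf C) (g ∘ ∣_∣) ⟩
  ∑[ D ∈ subsetsOf C ] g (suc ∣ D ∣) +ℤ ∑[ D ∈ subsetsOf C ] g ∣ D ∣
    ≡⟨ cong₂ _+ℤ_ (∑-subsetsOf-by-size C (g ∘ suc)) (∑-subsetsOf-by-size C g) ⟩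
  ∑[ D ∈ allSubsets ∣ C ∣ ] g (suc ∣ D ∣) +ℤ ∑[ D ∈ allSubsets ∣ C ∣ ] g ∣ D ∣
    ≡⟨ ∑-split (allSubsets ∣ C ∣) (g ∘ ∣_∣) ⟨
  ∑[ D ∈ allSubsets (suc ∣ C ∣) ] g ∣ D ∣ ∎
  where open ≡-Reasoning
∑-subsetsOf-by-size (false ∷ C) g = trans (∑-map (false ∷_) (subsetsOf C) (g ∘ ∣_∣)) (∑-subsetsOf-by-size C g)

1+∣W∣∸∣D∣ : ∀ {k} {W C : Subset k} → C ⊆ W → (g : ℕ → ℤ) →
            ∑[ D ∈ subsetsOf C ] g (suc (∣ W ∣ ∸ ∣ D ∣)) ≡ ∑[ D ∈ subsetsOf C ] g (suc ∣ W ∣ ∸ ∣ D ∣)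
1+∣W∣∸∣D∣ {C = C} C⊆W g =
  ∑-congᴬ (subsetsOf-⊆ C) λ D⊆C → cong g (sym (+-∸-assoc 1 (p⊆q⇒∣p∣≤∣q∣ (C⊆W ∘ D⊆C))))

-- Substitute D = W ─ A.
∑-complements : ∀ {k} {W C : Subset k} → C ⊆ W → (g : ℕ → ℤ) →
                ∑[ A ∈ subsetsOf W ] (if does (W ─ A ⊆? C) then g ∣ A ∣ else 0ℤ) ≡
                ∑[ D ∈ subsetsOf C ] g (∣ W ∣ ∸ ∣ D ∣)
∑-complements {W = []}      {[]}        _   g = refl
∑-complements {W = true ∷ W} {true ∷ C} C⊆W g = begin
  _ ≡⟨ ∑-split (subsetsOf W) _ ⟩
  _ ≡⟨ cong₂ _+ℤ_ (∑-complements (drop-∷-⊆ C⊆W) (g ∘ suc)) (∑-complements (drop-∷-⊆ C⊆W) g) ⟩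
  ∑[ D ∈ subsetsOf C ] g (suc (∣ W ∣ ∸ ∣ D ∣)) +ℤ ∑[ D ∈ subsetsOf C ] g (∣ W ∣ ∸ ∣ D ∣)
    ≡⟨ ℤ.+-comm (∑[ D ∈ subsetsOf C ] g (suc (∣ W ∣ ∸ ∣ D ∣))) _ ⟩
  ∑[ D ∈ subsetsOf C ] g (∣ W ∣ ∸ ∣ D ∣) +ℤ ∑[ D ∈ subsetsOf C ] g (suc (∣ W ∣ ∸ ∣ D ∣))
    ≡⟨ cong (∑[ D ∈ subsetsOf C ] g (∣ W ∣ ∸ ∣ D ∣) +ℤ_) (1+∣W∣∸∣D∣ (drop-∷-⊆ C⊆W) g) ⟩
  ∑[ D ∈ subsetsOf C ] g (∣ W ∣ ∸ ∣ D ∣) +ℤ ∑[ D ∈ subsetsOf C ] g (suc ∣ W ∣ ∸ ∣ D ∣)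
    ≡⟨ ∑-split (subsetsOf C) _ ⟨
  ∑[ D ∈ subsetsOf (true ∷ C) ] g (suc ∣ W ∣ ∸ ∣ D ∣) ∎
  where open ≡-Reasoning
∑-complements {W = true ∷ W} {false ∷ C} C⊆W g = begin
  _ ≡⟨ ∑-split (subsetsOf W) _ ⟩
  _ ≡⟨ cong₂ _+ℤ_ (∑-complements (drop-∷-⊆ C⊆W) (g ∘ suc)) (∑-0 (subsetsOf W)) ⟩
  ∑[ D ∈ subsetsOf C ] g (suc (∣ W ∣ ∸ ∣ D ∣)) +ℤ 0ℤ  ≡⟨ ℤ.+-identityʳ _ ⟩
  ∑[ D ∈ subsetsOf C ] g (suc (∣ W ∣ ∸ ∣ D ∣))          ≡⟨ 1+∣W∣∸∣D∣ (drop-∷-⊆ C⊆W) g ⟩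
  ∑[ D ∈ subsetsOf C ] g (suc ∣ W ∣ ∸ ∣ D ∣)           ≡⟨ ∑-map (false ∷_) (subsetsOf C) _ ⟨
  ∑[ D ∈ subsetsOf (false ∷ C) ] g (suc ∣ W ∣ ∸ ∣ D ∣) ∎
  where open ≡-Reasoning
∑-complements {W = false ∷ W} {false ∷ C} C⊆W g =
  trans (∑-map (false ∷_) (subsetsOf W) _)
  (trans (∑-complements (drop-∷-⊆ C⊆W) g) (sym (∑-map (false ∷_) (subsetsOf C) _)))
∑-complements {W = false ∷ W} {true ∷ C} C⊆W g with () ← C⊆W here

-- The pairs (A, S) correspond to the triples B ⊆ A ⊆ W via W = A ∪ S, B = A ∩ S, S = (W ─ A) ∪ B.
∑-reindex : ∀ n (f : Subset n → Subset n → ℤ) →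
            ∑[ A ∈ allSubsets n ] ∑[ S ∈ allSubsets n ] f A S ≡
            ∑[ W ∈ allSubsets n ] ∑[ A ∈ subsetsOf W ] ∑[ B ∈ subsetsOf A ] f A ((W ─ A) ∪ B)
∑-reindex zero    f = sym (ℤ.+-identityʳ _)
∑-reindex (suc n) f = begin
  ∑[ A ∈ allSubsets (suc n) ] ∑ (allSubsets (suc n)) (f A)
    ≡⟨ ∑-split (allSubsets n) (λ A → ∑ (allSubsets (suc n)) (f A)) ⟩
  ∑[ A ∈ allSubsets n ] ∑ (allSubsets (suc n)) (f (true ∷ A)) +ℤ
  ∑[ A ∈ allSubsets n ] ∑ (allSubsets (suc n)) (f (false ∷ A))
    ≡⟨ cong₂ _+ℤ_ (pairs true) (pairs false) ⟩
  (R true true +ℤ R true false) +ℤ (R false true +ℤ R false false)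
    ≡⟨ ℤ.+-assoc (R true true +ℤ R true false) _ _ ⟨
  (R true true +ℤ R true false) +ℤ R false true +ℤ R false false
    ≡⟨ cong₂ _+ℤ_ triples-true triples-false ⟨
  ∑[ W ∈ allSubsets n ] G (true ∷ W) +ℤ ∑[ W ∈ allSubsets n ] G (false ∷ W)
    ≡⟨ ∑-split (allSubsets n) G ⟨
  ∑[ W ∈ allSubsets (suc n) ] G W ∎
  where
  open ≡-Reasoning

  F : Bool → Bool → Subset n → Subset n → ℤ
  F b c A S = f (b ∷ A) (c ∷ S)

  R : Bool → Bool → ℤ
  R b c = ∑[ W ∈ allSubsets n ] ∑[ A ∈ subsetsOf W ] ∑[ B ∈ subsetsOf A ] F b c A ((W ─ A) ∪ B)

  pairs : ∀ b → ∑[ A ∈ allSubsets n ] ∑ (allSubsets (suc n)) (f (b ∷ A)) ≡ R b true +ℤ R b false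
  pairs b = begin
    ∑[ A ∈ allSubsets n ] ∑ (allSubsets (suc n)) (f (b ∷ A))
      ≡⟨ ∑-cong (allSubsets n) (λ A → ∑-split (allSubsets n) (f (b ∷ A))) ⟩
    ∑[ A ∈ allSubsets n ] (∑ (allSubsets n) (F b true A) +ℤ ∑ (allSubsets n) (F b false A))
      ≡⟨ ∑-+ (allSubsets n) _ _ ⟩
    ∑[ A ∈ allSubsets n ] ∑ (allSubsets n) (F b true A) +ℤ ∑[ A ∈ allSubsets n ] ∑ (allSubsets n) (F b false A)
      ≡⟨ cong₂ _+ℤ_ (∑-reindex n (F b true)) (∑-reindex n (F b false)) ⟩
    R b true +ℤ R b false ∎

  G : Subset (suc n) → ℤ
  G W = ∑[ A ∈ subsetsOf W ] ∑[ B ∈ subsetsOf A ] f A ((W ─ A) ∪ B)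

  inner : Bool → Bool → Subset n → Subset n → ℤ
  inner b c W A = ∑[ B ∈ subsetsOf A ] F b c A ((W ─ A) ∪ B)

  triples-true : ∑[ W ∈ allSubsets n ] G (true ∷ W) ≡ R true true +ℤ R true false +ℤ R false true
  triples-true = begin
    ∑[ W ∈ allSubsets n ] G (true ∷ W)
      ≡⟨ ∑-cong (allSubsets n) G-true ⟩
    ∑[ W ∈ allSubsets n ] (∑[ A ∈ subsetsOf W ] (inner true true W A +ℤ inner true false W A)
                            +ℤ ∑[ A ∈ subsetsOf W ] inner false true W A)
      ≡⟨ ∑-+ (allSubsets n) _ _ ⟩
    _ ≡⟨ cong (_+ℤ R false true) (trans (∑-cong (allSubsets n) (λ W → ∑-+ (subsetsOf W) _ _))
                                         (∑-+ (allSubsets n) _ _)) ⟩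
    R true true +ℤ R true false +ℤ R false true ∎
    where
    G-true : ∀ W → G (true ∷ W) ≡ ∑[ A ∈ subsetsOf W ] (inner true true W A +ℤ inner true false W A)
                                  +ℤ ∑[ A ∈ subsetsOf W ] inner false true W A
    G-true W = trans (∑-split (subsetsOf W) _)
      (cong₂ _+ℤ_ (∑-cong (subsetsOf W) (λ A → ∑-split (subsetsOf A) _))
                  (∑-cong (subsetsOf W) (λ A → ∑-map (false ∷_) (subsetsOf A) _)))

  triples-false : ∑[ W ∈ allSubsets n ] G (false ∷ W) ≡ R false false
  triples-false = ∑-cong (allSubsets n) λ W →
    trans (∑-map (false ∷_) (subsetsOf W) _) (∑-cong (subsetsOf W) (λ A → ∑-map (false ∷_) (subsetsOf A) _))

nonemptySizes : ℕ → List ℕ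
nonemptySizes zero    = List.[]
nonemptySizes (suc k) = List.map (suc ∘ ∣_∣) (allSubsets k) List.++ nonemptySizes k

nonemptySizes-≥1 : ∀ k → All (1 ≤_) (nonemptySizes k)
nonemptySizes-≥1 zero    = All.[]
nonemptySizes-≥1 (suc k) = All.++⁺ (All.map⁺ (All.universal (λ _ → s≤s z≤n) (allSubsets k))) (nonemptySizes-≥1 k)

∑-by-emptiness : ∀ k (Ψ : Bool → ℕ → ℤ) →
                 ∑[ u ∈ allSubsets k ] Ψ (nonemptyᵇ u) ∣ u ∣ ≡ Ψ false 0 +ℤ ∑ (nonemptySizes k) (Ψ true)
∑-by-emptiness zero    Ψ = refl
∑-by-emptiness (suc k) Ψ = begin
  ∑[ u ∈ allSubsets (suc k) ] Ψ (nonemptyᵇ u) ∣ u ∣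
    ≡⟨ ∑-split (allSubsets k) (λ u → Ψ (nonemptyᵇ u) ∣ u ∣) ⟩
  ∑[ u ∈ allSubsets k ] Ψ true (suc ∣ u ∣) +ℤ ∑[ u ∈ allSubsets k ] Ψ (nonemptyᵇ u) ∣ u ∣
    ≡⟨ cong (∑[ u ∈ allSubsets k ] Ψ true (suc ∣ u ∣) +ℤ_) (∑-by-emptiness k Ψ) ⟩
  ∑[ u ∈ allSubsets k ] Ψ true (suc ∣ u ∣) +ℤ (Ψ false 0 +ℤ ∑ (nonemptySizes k) (Ψ true))
    ≡⟨ ℤ+.x∙yz≈y∙xz (∑[ u ∈ allSubsets k ] Ψ true (suc ∣ u ∣)) (Ψ false 0) _ ⟩
  Ψ false 0 +ℤ (∑[ u ∈ allSubsets k ] Ψ true (suc ∣ u ∣) +ℤ ∑ (nonemptySizes k) (Ψ true))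
    ≡⟨ cong (Ψ false 0 +ℤ_) (cong (_+ℤ ∑ (nonemptySizes k) (Ψ true)) (∑-map (suc ∘ ∣_∣) (allSubsets k) (Ψ true))) ⟨
  Ψ false 0 +ℤ (∑ (List.map (suc ∘ ∣_∣) (allSubsets k)) (Ψ true) +ℤ ∑ (nonemptySizes k) (Ψ true))
    ≡⟨ cong (Ψ false 0 +ℤ_) (∑-++ (List.map (suc ∘ ∣_∣) (allSubsets k)) (nonemptySizes k) (Ψ true)) ⟨
  Ψ false 0 +ℤ ∑ (nonemptySizes (suc k)) (Ψ true) ∎
  where open ≡-Reasoning

module BlockSums (m : ℕ) where

  open Blocks m

  -- the sizes of the Y ⊆ T whose support is a given set of s elements
  blockSizes : ℕ → List ℕ
  blockSizes zero    = [ 0 ]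
  blockSizes (suc s) = List.concatMap (λ a → List.map (a +_) (blockSizes s)) (nonemptySizes m)

  blockSizes-≥ : ∀ s → All (s ≤_) (blockSizes s)
  blockSizes-≥ zero    = z≤n All.∷ All.[]
  blockSizes-≥ (suc s) = All.concat⁺ (All.map⁺ (All.map
    (λ 1≤a → All.map⁺ (All.map (+-mono-≤ 1≤a) (blockSizes-≥ s))) (nonemptySizes-≥1 m)))

  ∑-by-support : ∀ n (Φ : Subset n → ℕ → ℤ) →
                 ∑[ Y ∈ allSubsets (n * m) ] Φ (support n Y) ∣ Y ∣ ≡ ∑[ S ∈ allSubsets n ] ∑ (blockSizes ∣ S ∣) (Φ S)
  ∑-by-support zero    Φ = sym (ℤ.+-identityʳ _)
  ∑-by-support (suc n) Φ = begin
    ∑[ Y ∈ allSubsets (m + n * m) ] Φ (support (suc n) Y) ∣ Y ∣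
      ≡⟨ ∑-allSubsets-+ m (n * m) (λ Y → Φ (support (suc n) Y) ∣ Y ∣) ⟩
    ∑[ u ∈ allSubsets m ] ∑[ v ∈ allSubsets (n * m) ] Φ (support (suc n) (u ++ v)) ∣ u ++ v ∣
      ≡⟨ ∑-cong (allSubsets m) (λ u → ∑-cong (allSubsets (n * m)) λ v →
           cong₂ Φ (support-++ {n} u v) (∣p++q∣ u v)) ⟩
    ∑[ u ∈ allSubsets m ] Ψ (nonemptyᵇ u) ∣ u ∣
      ≡⟨ ∑-by-emptiness m Ψ ⟩
    Ψ false 0 +ℤ ∑[ a ∈ nonemptySizes m ] Ψ true a
      ≡⟨ cong₂ _+ℤ_ (∑-by-support n (λ S → Φ (false ∷ S)))
                    (∑-cong (nonemptySizes m) λ a → ∑-by-support n λ S k → Φ (true ∷ S) (a + k)) ⟩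
    ∑[ S ∈ allSubsets n ] ∑ (blockSizes ∣ S ∣) (Φ (false ∷ S)) +ℤ
    ∑[ a ∈ nonemptySizes m ] ∑[ S ∈ allSubsets n ] ∑[ k ∈ blockSizes ∣ S ∣ ] Φ (true ∷ S) (a + k)
      ≡⟨ cong (P +ℤ_) (∑-comm (nonemptySizes m) (allSubsets n) λ a S → ∑[ k ∈ blockSizes ∣ S ∣ ] Φ (true ∷ S) (a + k)) ⟩
    ∑[ S ∈ allSubsets n ] ∑ (blockSizes ∣ S ∣) (Φ (false ∷ S)) +ℤ
    ∑[ S ∈ allSubsets n ] ∑[ a ∈ nonemptySizes m ] ∑[ k ∈ blockSizes ∣ S ∣ ] Φ (true ∷ S) (a + k)
      ≡⟨ cong (P +ℤ_) (∑-cong (allSubsets n) blockSizes-suc) ⟨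
    ∑[ S ∈ allSubsets n ] ∑ (blockSizes ∣ S ∣) (Φ (false ∷ S)) +ℤ
    ∑[ S ∈ allSubsets n ] ∑ (blockSizes (suc ∣ S ∣)) (Φ (true ∷ S))
      ≡⟨ ℤ.+-comm P _ ⟩
    _ ≡⟨ ∑-split (allSubsets n) (λ S → ∑ (blockSizes ∣ S ∣) (Φ S)) ⟨
    ∑[ S ∈ allSubsets (suc n) ] ∑ (blockSizes ∣ S ∣) (Φ S) ∎
    where
    open ≡-Reasoning
    Ψ : Bool → ℕ → ℤ
    Ψ b a = ∑[ v ∈ allSubsets (n * m) ] Φ (b ∷ support n v) (a + ∣ v ∣)
    P : ℤ
    P = ∑[ S ∈ allSubsets n ] ∑ (blockSizes ∣ S ∣) (Φ (false ∷ S))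
    blockSizes-suc : ∀ S → ∑ (blockSizes (suc ∣ S ∣)) (Φ (true ∷ S)) ≡
                           ∑[ a ∈ nonemptySizes m ] ∑[ k ∈ blockSizes ∣ S ∣ ] Φ (true ∷ S) (a + k)
    blockSizes-suc S = trans (∑-concatMap (λ a → List.map (a +_) (blockSizes ∣ S ∣)) (nonemptySizes m) (Φ (true ∷ S)))
      (∑-cong (nonemptySizes m) λ a → ∑-map (a +_) (blockSizes ∣ S ∣) (Φ (true ∷ S)))

-- Tutte polynomials of the three deletions

⊓-suc-cases : ∀ ρA ρW d k → ρW ≤ ρA + d → d ≤ k → (p? : Dec (ρA + d ≡ ρW)) (q? : Dec (k ≡ d)) →
              (ρA + k) ⊓ suc ρW ≡ (if does p? ∧ does q? then ρW else suc ρW)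
⊓-suc-cases ρA ρW d k ρW≤ d≤k (yes refl) (yes refl) = m≤n⇒m⊓n≡m (n≤1+n _)
⊓-suc-cases ρA ρW d k ρW≤ d≤k (yes refl) (no k≢d)   =
  m≥n⇒m⊓n≡n (≤-trans (≤-reflexive (sym (+-suc ρA d))) (+-monoʳ-≤ ρA (≤∧≢⇒< d≤k (k≢d ∘ sym))))
⊓-suc-cases ρA ρW d k ρW≤ d≤k (no ≢ρW)   _          =
  m≥n⇒m⊓n≡n (≤-trans (≤∧≢⇒< ρW≤ (≢ρW ∘ sym)) (+-monoʳ-≤ ρA d≤k))

if-split : ∀ (G : Bool → ℤ) b → G b ≡ G false +ℤ (if b then G true -ℤ G false else 0ℤ)
if-split G true  = b≡a+[b-a] (G false) (G true)
  where
  b≡a+[b-a] : ∀ a b → b ≡ a +ℤ (b -ℤ a)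
  b≡a+[b-a] = solve-∀
if-split G false = sym (ℤ.+-identityʳ (G false))

module TutteSums (m : ℕ) (x y : ℤ) where

  open BlockSums m

  tutteTerm : ℕ → ℕ → ℕ → ℤ
  tutteTerm R s ρ = ((x -ℤ 1ℤ) ^ (R ∸ ρ)) *ℤ ((y -ℤ 1ℤ) ^ (s ∸ ρ))

  -- the contribution of the subsets α ∷ (⊥ ++ Y) of Q ∖ E whose support is a set of size s and rank ρ
  summandTip : Bool → ℕ → ℕ × ℕ × ℕ → ℤ
  summandTip α R (s , ρ , _) = ∑[ k ∈ blockSizes s ] tutteTerm R (bit α + k) ((bit α + k) ⊓ suc ρ)

  summand∖E : ℕ → ℕ × ℕ × ℕ → ℤ
  summand∖E R t = summandTip true R t +ℤ summandTip false R t

  -- the contribution of the subsets false ∷ (A ++ Y) of Q ∖ a with A ∪ support Y = W, where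
  -- ∣ W ∣ = w, r W = ρ, ∣ A ∣ = a, and b records whether W ─ A consists of coloops of M|W
  sum∖a : ℕ → ℕ → ℕ → ℕ → Bool → ℤ
  sum∖a R w ρ a b = ∑[ B ∈ allSubsets a ] ∑[ k ∈ blockSizes (w ∸ a + ∣ B ∣) ]
    tutteTerm R (a + k) (if b ∧ does (k ≟ w ∸ a) then ρ else suc ρ)

  summand∖a : ℕ → ℕ × ℕ × ℕ → ℤ
  summand∖a R (w , ρ , c) =
    ∑[ A ∈ allSubsets w ] sum∖a R w ρ ∣ A ∣ false +ℤ
    ∑[ D ∈ allSubsets c ] (sum∖a R w ρ (w ∸ ∣ D ∣) true -ℤ sum∖a R w ρ (w ∸ ∣ D ∣) false)

module ConeTutte (m : ℕ) (1≤m : 1 ≤ m) {n : ℕ} (M : Matroid n) (Q : Matroid (ConeSize n m))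
                 (cone : IsFreeCone m M Q) (x y : ℤ) where

  open Blocks m
  open BlockSums m
  open TutteSums m x y
  open ConeRank m M Q cone
  open MatroidProperties M
    using (r; r-⊥; r≤r+∣─∣; coloopSet; coloopSet⊆; coloops≡∣coloopSet∣; spanning⇔⊆coloopSet)

  term : ℕ → Subset (ConeSize n m) → ℤ
  term R X = tutteTerm R ∣ X ∣ (rQ X)

  ∑-tipTerm : ∀ α R →
              ∑[ Y ∈ allSubsets (n * m) ] term R (α ∷ (⊥ {n} ++ Y)) ≡ ∑ (srcData M) (summandTip α R)
  ∑-tipTerm α R = begin
    ∑[ Y ∈ allSubsets (n * m) ] term R (α ∷ (⊥ {n} ++ Y))
      ≡⟨ ∑-cong (allSubsets (n * m)) (λ Y → cong₂ (tutteTerm R) (size-tip Y) (rank-tip Y)) ⟩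
    ∑[ Y ∈ allSubsets (n * m) ] Φ (support n Y) ∣ Y ∣
      ≡⟨ ∑-by-support n Φ ⟩
    ∑[ S ∈ allSubsets n ] summandTip α R (∣ S ∣ , r S , coloops M S)
      ≡⟨ ∑-map (λ S → ∣ S ∣ , r S , coloops M S) (allSubsets n) (summandTip α R) ⟨
    ∑ (srcData M) (summandTip α R) ∎
    where
    open ≡-Reasoning
    Φ : Subset n → ℕ → ℤ
    Φ S k = tutteTerm R (bit α + k) ((bit α + k) ⊓ suc (r S))
    size-tip : ∀ Y → ∣ α ∷ (⊥ {n} ++ Y) ∣ ≡ bit α + ∣ Y ∣
    size-tip Y =
      trans (∣x∷p∣ α (⊥ {n} ++ Y)) (cong (bit α +_) (trans (∣p++q∣ (⊥ {n}) Y) (cong (_+ ∣ Y ∣) (∣⊥∣≡0 n))))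
    rank-tip : ∀ Y → rQ (α ∷ (⊥ {n} ++ Y)) ≡ (bit α + ∣ Y ∣) ⊓ suc (r (support n Y))
    rank-tip Y =
      trans (rank-cone α (⊥ {n}) Y) (cong₂ (λ a S → (a + bit α + ∣ Y ∣) ⊓ suc (r S)) r-⊥ (∪-identityˡ _))

  ∑-subsetsOf-⊥++⊤ : ∀ (f : Subset (n + n * m) → ℤ) →
                     ∑ (subsetsOf (⊥ {n} ++ ⊤ {n * m})) f ≡ ∑[ Y ∈ allSubsets (n * m) ] f (⊥ {n} ++ Y)
  ∑-subsetsOf-⊥++⊤ f = begin
    ∑ (subsetsOf (⊥ {n} ++ ⊤ {n * m})) f
      ≡⟨ ∑-subsetsOf-++ (⊥ {n}) (⊤ {n * m}) f ⟩
    ∑[ A ∈ subsetsOf (⊥ {n}) ] ∑[ Y ∈ subsetsOf (⊤ {n * m}) ] f (A ++ Y)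
      ≡⟨ cong₂ (λ As Ys → ∑[ A ∈ As ] ∑[ Y ∈ Ys ] f (A ++ Y)) (subsetsOf-⊥ n) (subsetsOf-⊤ (n * m)) ⟩
    ∑[ A ∈ [ ⊥ {n} ] ] ∑[ Y ∈ allSubsets (n * m) ] f (A ++ Y)
      ≡⟨ ∑-[x] (⊥ {n}) (λ A → ∑[ Y ∈ allSubsets (n * m) ] f (A ++ Y)) ⟩
    ∑[ Y ∈ allSubsets (n * m) ] f (⊥ {n} ++ Y) ∎
    where open ≡-Reasoning

  tutte∖Ea-sum : ∀ R → ∑ (subsetsOf (groundMinusEa n m)) (term R) ≡ ∑ (srcData M) (summandTip false R)
  tutte∖Ea-sum R = trans (∑-map (false ∷_) (subsetsOf (⊥ {n} ++ ⊤ {n * m})) (term R))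
                  (trans (∑-subsetsOf-⊥++⊤ (term R ∘ (false ∷_))) (∑-tipTerm false R))

  tutte∖E-sum : ∀ R → ∑ (subsetsOf (groundMinusE n m)) (term R) ≡ ∑ (srcData M) (summand∖E R)
  tutte∖E-sum R = begin
    ∑ (subsetsOf (groundMinusE n m)) (term R)
      ≡⟨ ∑-split (subsetsOf (⊥ {n} ++ ⊤ {n * m})) (term R) ⟩
    ∑ (subsetsOf (⊥ {n} ++ ⊤ {n * m})) (term R ∘ (true ∷_)) +ℤ ∑ (subsetsOf (⊥ {n} ++ ⊤ {n * m})) (term R ∘ (false ∷_))
      ≡⟨ cong₂ _+ℤ_ (trans (∑-subsetsOf-⊥++⊤ (term R ∘ (true ∷_))) (∑-tipTerm true R))
                    (trans (∑-subsetsOf-⊥++⊤ (term R ∘ (false ∷_))) (∑-tipTerm false R)) ⟩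
    ∑ (srcData M) (summandTip true R) +ℤ ∑ (srcData M) (summandTip false R)
      ≡⟨ ∑-+ (srcData M) (summandTip true R) (summandTip false R) ⟨
    ∑ (srcData M) (summand∖E R) ∎
    where open ≡-Reasoning

  Φ∖a : ℕ → Subset n → Subset n → ℕ → ℤ
  Φ∖a R A S k = tutteTerm R (∣ A ∣ + k) ((r A + k) ⊓ suc (r (A ∪ S)))

  tutte∖a-pairs : ∀ R → ∑ (subsetsOf (groundMinusTip n m)) (term R) ≡
                        ∑[ A ∈ allSubsets n ] ∑[ S ∈ allSubsets n ] ∑ (blockSizes ∣ S ∣) (Φ∖a R A S)
  tutte∖a-pairs R = begin
    ∑ (subsetsOf (groundMinusTip n m)) (term R)
      ≡⟨ ∑-map (false ∷_) (subsetsOf (⊤ {n} ++ ⊤ {n * m})) (term R) ⟩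
    ∑[ X ∈ subsetsOf (⊤ {n} ++ ⊤ {n * m}) ] term R (false ∷ X)
      ≡⟨ ∑-subsetsOf-++ (⊤ {n}) (⊤ {n * m}) _ ⟩
    ∑[ A ∈ subsetsOf (⊤ {n}) ] ∑[ Y ∈ subsetsOf (⊤ {n * m}) ] term R (false ∷ (A ++ Y))
      ≡⟨ cong₂ (λ As Ys → ∑[ A ∈ As ] ∑[ Y ∈ Ys ] term R (false ∷ (A ++ Y))) (subsetsOf-⊤ n) (subsetsOf-⊤ (n * m)) ⟩
    ∑[ A ∈ allSubsets n ] ∑[ Y ∈ allSubsets (n * m) ] term R (false ∷ (A ++ Y))
      ≡⟨ ∑-cong (allSubsets n) (λ A → ∑-cong (allSubsets (n * m)) λ Y →
           cong₂ (tutteTerm R) (∣p++q∣ A Y) (rank-pair A Y)) ⟩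
    ∑[ A ∈ allSubsets n ] ∑[ Y ∈ allSubsets (n * m) ] Φ∖a R A (support n Y) ∣ Y ∣
      ≡⟨ ∑-cong (allSubsets n) (λ A → ∑-by-support n (Φ∖a R A)) ⟩
    ∑[ A ∈ allSubsets n ] ∑[ S ∈ allSubsets n ] ∑ (blockSizes ∣ S ∣) (Φ∖a R A S) ∎
    where
    open ≡-Reasoning
    rank-pair : ∀ A Y → rQ (false ∷ (A ++ Y)) ≡ (r A + ∣ Y ∣) ⊓ suc (r (A ∪ support n Y))
    rank-pair A Y =
      trans (rank-cone false A Y) (cong (λ a → (a + ∣ Y ∣) ⊓ suc (r (A ∪ support n Y))) (+-identityʳ (r A)))

  W─A⊆coloopsᵇ : Subset n → Subset n → Bool
  W─A⊆coloopsᵇ W A = does (W ─ A ⊆? coloopSet W)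

  Φ∖a-triple : ∀ R {W A B} → A ⊆ W → B ⊆ A →
               ∑ (blockSizes ∣ (W ─ A) ∪ B ∣) (Φ∖a R A ((W ─ A) ∪ B)) ≡
               ∑[ k ∈ blockSizes (∣ W ∣ ∸ ∣ A ∣ + ∣ B ∣) ]
                 tutteTerm R (∣ A ∣ + k) (if W─A⊆coloopsᵇ W A ∧ does (k ≟ ∣ W ∣ ∸ ∣ A ∣) then r W else suc (r W))
  Φ∖a-triple R {W} {A} {B} A⊆W B⊆A =
    trans (cong (λ s → ∑ (blockSizes s) (Φ∖a R A ((W ─ A) ∪ B))) (∣W─A∪B∣≡∣W∣∸∣A∣+∣B∣ A⊆W B⊆A))
          (∑-congᴬ (blockSizes-≥ _) λ {k} k≥ → cong (tutteTerm R (∣ A ∣ + k)) (rank-term k (≤-trans (m≤m+n d ∣ B ∣) k≥)))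
    where
    d : ℕ
    d = ∣ W ∣ ∸ ∣ A ∣
    spanning⇔ : (r A + d ≡ r W) ⇔ (W ─ A ⊆ coloopSet W)
    spanning⇔ = subst (λ d → (r A + d ≡ r W) ⇔ (W ─ A ⊆ coloopSet W)) (∣W─A∣≡∣W∣∸∣A∣ A⊆W) (spanning⇔⊆coloopSet A⊆W)
    rW≤ : r W ≤ r A + d
    rW≤ = subst (λ d → r W ≤ r A + d) (∣W─A∣≡∣W∣∸∣A∣ A⊆W) (r≤r+∣─∣ W A)
    rank-term : ∀ k → d ≤ k → (r A + k) ⊓ suc (r (A ∪ ((W ─ A) ∪ B))) ≡
                              (if W─A⊆coloopsᵇ W A ∧ does (k ≟ d) then r W else suc (r W))
    rank-term k d≤k = begin
      (r A + k) ⊓ suc (r (A ∪ ((W ─ A) ∪ B)))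
        ≡⟨ cong (λ Z → (r A + k) ⊓ suc (r Z)) (A∪W─A∪B≡W A⊆W B⊆A) ⟩
      (r A + k) ⊓ suc (r W)
        ≡⟨ ⊓-suc-cases (r A) (r W) d k rW≤ d≤k (r A + d ≟ r W) (k ≟ d) ⟩
      (if does (r A + d ≟ r W) ∧ does (k ≟ d) then r W else suc (r W))
        ≡⟨ cong (λ b → if b ∧ does (k ≟ d) then r W else suc (r W))
                (does-⇔ spanning⇔ (r A + d ≟ r W) (W ─ A ⊆? coloopSet W)) ⟩
      (if W─A⊆coloopsᵇ W A ∧ does (k ≟ d) then r W else suc (r W)) ∎
      where open ≡-Reasoning

  summand∖a-at : ∀ R W → ∑[ A ∈ subsetsOf W ] sum∖a R ∣ W ∣ (r W) (∣ A ∣) (W─A⊆coloopsᵇ W A) ≡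
                         summand∖a R (∣ W ∣ , r W , coloops M W)
  summand∖a-at R W = begin
    ∑[ A ∈ subsetsOf W ] Γ (∣ A ∣) (W─A⊆coloopsᵇ W A)
      ≡⟨ ∑-cong (subsetsOf W) (λ A → if-split (Γ (∣ A ∣)) (W─A⊆coloopsᵇ W A)) ⟩
    ∑[ A ∈ subsetsOf W ] (Γ (∣ A ∣) false +ℤ (if W─A⊆coloopsᵇ W A then g (∣ A ∣) else 0ℤ))
      ≡⟨ ∑-+ (subsetsOf W) _ _ ⟩
    ∑[ A ∈ subsetsOf W ] Γ (∣ A ∣) false +ℤ ∑[ A ∈ subsetsOf W ] (if W─A⊆coloopsᵇ W A then g (∣ A ∣) else 0ℤ)
      ≡⟨ cong₂ _+ℤ_ (∑-subsetsOf-by-size W (λ a → Γ a false)) (∑-complements (coloopSet⊆ W) g) ⟩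
    ∑[ A ∈ allSubsets (∣ W ∣) ] Γ (∣ A ∣) false +ℤ ∑[ D ∈ subsetsOf (coloopSet W) ] g (∣ W ∣ ∸ ∣ D ∣)
      ≡⟨ cong (P +ℤ_) (∑-subsetsOf-by-size (coloopSet W) (λ d → g (∣ W ∣ ∸ d))) ⟩
    ∑[ A ∈ allSubsets (∣ W ∣) ] Γ (∣ A ∣) false +ℤ ∑[ D ∈ allSubsets (∣ coloopSet W ∣) ] g (∣ W ∣ ∸ ∣ D ∣)
      ≡⟨ cong (λ c → P +ℤ ∑[ D ∈ allSubsets c ] g (∣ W ∣ ∸ ∣ D ∣)) (coloops≡∣coloopSet∣ W) ⟨
    summand∖a R (∣ W ∣ , r W , coloops M W) ∎
    where
    open ≡-Reasoning
    Γ : ℕ → Bool → ℤ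
    Γ = sum∖a R ∣ W ∣ (r W)
    g : ℕ → ℤ
    g a = Γ a true -ℤ Γ a false
    P : ℤ
    P = ∑[ A ∈ allSubsets (∣ W ∣) ] Γ (∣ A ∣) false

  tutte∖a-sum : ∀ R → ∑ (subsetsOf (groundMinusTip n m)) (term R) ≡ ∑ (srcData M) (summand∖a R)
  tutte∖a-sum R = begin
    ∑ (subsetsOf (groundMinusTip n m)) (term R)
      ≡⟨ tutte∖a-pairs R ⟩
    ∑[ A ∈ allSubsets n ] ∑[ S ∈ allSubsets n ] ∑ (blockSizes ∣ S ∣) (Φ∖a R A S)
      ≡⟨ ∑-reindex n (λ A S → ∑ (blockSizes ∣ S ∣) (Φ∖a R A S)) ⟩
    ∑[ W ∈ allSubsets n ] ∑[ A ∈ subsetsOf W ] ∑[ B ∈ subsetsOf A ]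
      ∑ (blockSizes ∣ (W ─ A) ∪ B ∣) (Φ∖a R A ((W ─ A) ∪ B))
      ≡⟨ ∑-cong (allSubsets n) (λ W → ∑-congᴬ (subsetsOf-⊆ W) λ A⊆W →
           ∑-congᴬ (subsetsOf-⊆ _) λ B⊆A → Φ∖a-triple R A⊆W B⊆A) ⟩
    ∑[ W ∈ allSubsets n ] ∑[ A ∈ subsetsOf W ] ∑[ B ∈ subsetsOf A ] ∑[ k ∈ blockSizes (∣ W ∣ ∸ ∣ A ∣ + ∣ B ∣) ]
      tutteTerm R (∣ A ∣ + k) (if W─A⊆coloopsᵇ W A ∧ does (k ≟ ∣ W ∣ ∸ ∣ A ∣) then r W else suc (r W))
      ≡⟨ ∑-cong (allSubsets n) (λ W → ∑-cong (subsetsOf W) λ A → ∑-subsetsOf-by-size A λ b →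
           ∑[ k ∈ blockSizes (∣ W ∣ ∸ ∣ A ∣ + b) ]
             tutteTerm R (∣ A ∣ + k) (if W─A⊆coloopsᵇ W A ∧ does (k ≟ ∣ W ∣ ∸ ∣ A ∣) then r W else suc (r W))) ⟩
    ∑[ W ∈ allSubsets n ] ∑[ A ∈ subsetsOf W ] sum∖a R ∣ W ∣ (r W) (∣ A ∣) (W─A⊆coloopsᵇ W A)
      ≡⟨ ∑-cong (allSubsets n) (summand∖a-at R) ⟩
    ∑[ W ∈ allSubsets n ] summand∖a R (∣ W ∣ , r W , coloops M W)
      ≡⟨ ∑-map (λ S → ∣ S ∣ , r S , coloops M S) (allSubsets n) (summand∖a R) ⟨
    ∑ (srcData M) (summand∖a R) ∎
    where open ≡-Reasoning

  rQ-groundMinusTip : rQ (groundMinusTip n m) ≡ (r ⊤ + n * m) ⊓ suc (r ⊤)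
  rQ-groundMinusTip = begin
    rQ (groundMinusTip n m)
      ≡⟨ rank-cone false ⊤ ⊤ ⟩
    (r ⊤ + 0 + ∣ ⊤ {n * m} ∣) ⊓ suc (r (⊤ ∪ support n ⊤))
      ≡⟨ cong₂ (λ k S → (r ⊤ + 0 + k) ⊓ suc (r S)) (∣⊤∣≡n (n * m)) (∪-zeroˡ _) ⟩
    (r ⊤ + 0 + n * m) ⊓ suc (r ⊤)
      ≡⟨ cong (λ a → (a + n * m) ⊓ suc (r ⊤)) (+-identityʳ (r ⊤)) ⟩
    (r ⊤ + n * m) ⊓ suc (r ⊤) ∎
    where open ≡-Reasoning

  rQ-tip : ∀ α → rQ (α ∷ (⊥ {n} ++ ⊤ {n * m})) ≡ (bit α + n * m) ⊓ suc (r ⊤)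
  rQ-tip α = begin
    rQ (α ∷ (⊥ {n} ++ ⊤ {n * m}))
      ≡⟨ rank-cone α ⊥ ⊤ ⟩
    (r ⊥ + bit α + ∣ ⊤ {n * m} ∣) ⊓ suc (r (⊥ ∪ support n ⊤))
      ≡⟨ cong₂ (λ a k → (a + bit α + k) ⊓ suc (r (⊥ ∪ support n ⊤))) r-⊥ (∣⊤∣≡n (n * m)) ⟩
    (bit α + n * m) ⊓ suc (r (⊥ ∪ support n ⊤))
      ≡⟨ cong (λ S → (bit α + n * m) ⊓ suc (r S)) (trans (∪-identityˡ _) (support-⊤ 1≤m n)) ⟩
    (bit α + n * m) ⊓ suc (r ⊤) ∎
    where open ≡-Reasoning

  tutte∖a : tutteRestr Q (groundMinusTip n m) x y ≡ ∑ (srcData M) (summand∖a ((r ⊤ + n * m) ⊓ suc (r ⊤)))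
  tutte∖a = trans (tutte∖a-sum _) (cong (λ R → ∑ (srcData M) (summand∖a R)) rQ-groundMinusTip)

  tutte∖E : tutteRestr Q (groundMinusE n m) x y ≡ ∑ (srcData M) (summand∖E (suc (n * m) ⊓ suc (r ⊤)))
  tutte∖E = trans (tutte∖E-sum _) (cong (λ R → ∑ (srcData M) (summand∖E R)) (rQ-tip true))

  tutte∖Ea : tutteRestr Q (groundMinusEa n m) x y ≡ ∑ (srcData M) (summandTip false (n * m ⊓ suc (r ⊤)))
  tutte∖Ea = trans (tutte∖Ea-sum _) (cong (λ R → ∑ (srcData M) (summandTip false R)) (rQ-tip false))

⊤∈allSubsets : ∀ n → ⊤ ∈ₗ allSubsets n
⊤∈allSubsets zero    = here refl
⊤∈allSubsets (suc n) = ∈-++⁺ˡ (∈-map⁺ (true ∷_) (⊤∈allSubsets n))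

srcTriple : ∀ {k} → Matroid k → Subset k → ℕ × ℕ × ℕ
srcTriple M S = ∣ S ∣ , rank M S , coloops M S

srcData-full : ∀ {n n′} (M : Matroid n) (N : Matroid n′) → srcData M ↭ srcData N →
               ∃[ S ] (∣ S ∣ ≡ n × rank N S ≡ rank M ⊤)
srcData-full {n} M N M↭N
  with ∈-map⁻ (srcTriple N) (∈-resp-↭ M↭N (∈-map⁺ (srcTriple M) (⊤∈allSubsets n)))
... | S , _ , ≡triple = S , trans (sym (cong proj₁ ≡triple)) (∣⊤∣≡n n) , sym (cong (proj₁ ∘ proj₂) ≡triple)

srcData-size : ∀ {n n′} (M : Matroid n) (N : Matroid n′) → srcData M ↭ srcData N → n ≡ n′
srcData-size M N M↭N = ≤-antisym (bound M N M↭N) (bound N M (↭-sym M↭N))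
  where
  bound : ∀ {n n′} (M : Matroid n) (N : Matroid n′) → srcData M ↭ srcData N → n ≤ n′
  bound {n′ = n′} M N M↭N with srcData-full M N M↭N
  ... | S , ∣S∣≡n , _ = subst (_≤ n′) ∣S∣≡n (∣p∣≤n S)

srcData-rank : ∀ {n} (M N : Matroid n) → srcData M ↭ srcData N → rank M ⊤ ≡ rank N ⊤
srcData-rank M N M↭N with srcData-full M N M↭N
... | S , ∣S∣≡n , rS≡ = trans (sym rS≡) (cong (rank N) (∣p∣≡n⇒p≡⊤ ∣S∣≡n))

∑-srcData : ∀ {n} (M N : Matroid n) → srcData M ↭ srcData N → (h : ℕ → ℕ × ℕ × ℕ → ℤ) →
            ∑ (srcData M) (h (rank M ⊤)) ≡ ∑ (srcData N) (h (rank N ⊤))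
∑-srcData M N M↭N h = trans (cong (λ ρ → ∑ (srcData M) (h ρ)) (srcData-rank M N M↭N)) (∑-↭ M↭N (h (rank N ⊤)))

corollary5p2 : (m : ℕ) → 1 ≤ m → {n n′ : ℕ} (M : Matroid n) (N : Matroid n′) →
    Loopless M → Loopless N → srcData M ↭ srcData N →
    (QM : Matroid (ConeSize n m)) (QN : Matroid (ConeSize n′ m)) →
    IsFreeCone m M QM → IsFreeCone m N QN →
    ((x y : ℤ) → tutteRestr QM (groundMinusTip n m) x y ≡ tutteRestr QN (groundMinusTip n′ m) x y)
    × ((x y : ℤ) → tutteRestr QM (groundMinusE n m) x y ≡ tutteRestr QN (groundMinusE n′ m) x y)
    × ((x y : ℤ) → tutteRestr QM (groundMinusEa n m) x y ≡ tutteRestr QN (groundMinusEa n′ m) x y)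
corollary5p2 m 1≤m {n} M N _ _ M↭N QM QN coneM coneN with srcData-size M N M↭N
... | refl =
    (λ x y → via x y (groundMinusTip n m) (λ ρ → TutteSums.summand∖a m x y ((ρ + n * m) ⊓ suc ρ))
                     (λ {K} {Q} cone → ConeTutte.tutte∖a m 1≤m K Q cone x y))
  , (λ x y → via x y (groundMinusE n m) (λ ρ → TutteSums.summand∖E m x y (suc (n * m) ⊓ suc ρ))
                     (λ {K} {Q} cone → ConeTutte.tutte∖E m 1≤m K Q cone x y))
  , (λ x y → via x y (groundMinusEa n m) (λ ρ → TutteSums.summandTip m x y false (n * m ⊓ suc ρ))
                     (λ {K} {Q} cone → ConeTutte.tutte∖Ea m 1≤m K Q cone x y))
  where
  via : ∀ x y S (h : ℕ → ℕ × ℕ × ℕ → ℤ) →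
        (∀ {K Q} → IsFreeCone m K Q → tutteRestr Q S x y ≡ ∑ (srcData K) (h (rank K ⊤))) →
        tutteRestr QM S x y ≡ tutteRestr QN S x y
  via x y S h tutte≡ = trans (tutte≡ {M} {QM} coneM) (trans (∑-srcData M N M↭N h) (sym (tutte≡ {N} {QN} coneN)))
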